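{- Let $m,n\ge1$. The map $\phi:\mathsf{EW}_{m,n}\to\mathsf{LRib}_{m,n}$ described in the context is a bijection.
   Context: All tableaux are $0/1$ arrays; $T_{ij}$ denotes the entry in row $i$ (rows numbered top to bottom) and column $j$ (columns numbered left to right). Labels are symbols $v_0,v_1,\dots,v_{m+n-1}$, ordered by $v_i<v_j$ iff $i<j$. Rectangular EW-tableau: an $m\times n$ $0/1$ tableau $T$ such that (i) every entry of the top row is $1$; (ii) every other row contains at least one $0$; (iii) there are no rows $i\ne i'$ and columns $k\ne k'$ with $T_{ik}=T_{i'k'}=0$ and $T_{ik'}=T_{i'k}=1$. $\mathsf{EW}_{m,n}$ is the set of these. The rows of $T$ are labelled $v_0,\dots,v_{m-1}$ from top to bottom and the columns $v_m,\dots,v_{m+n-1}$ from left to right. Parallelogram polyomino of type $(m,n)$: an $m\times n$ $0/1$ tableau $P$ with $P_{11}=P_{mn}=1$, such that every row contains at least one $1$ and the $1$s in each row are contiguous, and for each $2\le i\le m$: the leftmost $1$ of row $i$ is weakly to the right of the leftmost $1$ of row $i-1$ and weakly to the left of the rightmost $1$ of row $i-1$, and the rightmost $1$ of row $i$ is weakly to the right of the rightmost $1$ of row $i-1$. It is a ribbon parallelogram polyomino if it has exactly $m+n-1$ entries equal to $1$. Labelled parallelogram polyomino of type $(m,n)$: a pair $(P,\ell)$ with $P$ a parallelogram polyomino of type $(m,n)$ and $\ell=(\ell(\mathrm{row}_1),\dots,\ell(\mathrm{row}_m),\ell(\mathrm{col}_1),\dots,\ell(\mathrm{col}_n))$, where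 the row labels are a permutation of $\{v_0,\dots,v_{m-1}\}$ with $\ell(\mathrm{row}_1)=v_0$ and such that the labels of rows whose leftmost $1$s lie in the same column are increasing from top to bottom, and the column labels are a permutation of $\{v_m,\dots,v_{m+n-1}\}$ such that the labels of columns whose topmost $1$s lie in the same row are increasing from left to right. $\mathsf{LRib}_{m,n}$ is the set of those with $P$ a ribbon parallelogram polyomino. The map $\phi$: given $T\in\mathsf{EW}_{m,n}$ with its labels, (1) permute the columns (carrying their labels) so that every entry to the left of a $0$ is a $0$, with identical columns placed so their labels increase from left to right; (2) then permute the rows (carrying labels) so that every entry above a $1$ is a $1$, with identical rows placed so their labels increase from top to bottom; call the result $T'$ and the resulting labelling $\ell$. (3) Let $R$ be the $m\times n$ tableau with $R_{ij}=1$ if either [$T'_{ij}=1$ and ($i=m$ or $T'_{i+1,j}=0$)] or [$T'_{ij}=0$ and ($j=n$ or $T'_{i,j+1}=1$)], and $R_{ij}=0$ otherwise. Set $\phi(T)=(R,\ell)$; this lies in $\mathsf{LRib}_{m,n}$. -}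

module Defs where

open import Data.Bool using (Bool; true; false; not; _∧_; _∨_; if_then_else_)
open import Data.Nat using (ℕ; zero; suc; _+_; _∸_; _≤ᵇ_; _≡ᵇ_)
import Data.Nat as N
open import Data.Fin using (Fin; toℕ; _<_; _≤_)
open import Data.Vec using (Vec; []; _∷_; lookup; tabulate; map; toList)
import Data.Vec as V
open import Data.List using (List; upTo)
import Data.List as L
open import Data.List.Relation.Binary.Permutation.Propositional using (_↭_)
open import Data.Maybe using (Maybe; just; nothing; maybe)
open import Data.Product using (Σ; ∃; ∃-syntax; _×_; _,_; proj₁; proj₂)
open import Relation.Binary.PropositionalEquality using (_≡_; _≢_)
open import Relation.Nullary using (¬_)

-- Tableaux: an m × n 0/1 array, stored as m rows of length n.
-- The entry 1 is represented by true, 0 by false.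

Tableau : ℕ → ℕ → Set
Tableau m n = Vec (Vec Bool n) m

-- T ⟨ i , j ⟩ is the entry in row i (0-based from the top)
-- and column j (0-based from the left).
_⟨_,_⟩ : ∀ {m n} → Tableau m n → Fin m → Fin n → Bool
T ⟨ i , j ⟩ = lookup (lookup T i) j

countB : ∀ {k} → Bool → Vec Bool k → ℕ
countB b [] = 0
countB true  (true  ∷ xs) = suc (countB true xs)
countB false (false ∷ xs) = suc (countB false xs)
countB true  (false ∷ xs) = countB true xs
countB false (true  ∷ xs) = countB false xs

record IsEW {m n : ℕ} (T : Tableau m n) : Set where
  field
    topRow   : ∀ (i : Fin m) (j : Fin n) → toℕ i ≡ 0 → T ⟨ i , j ⟩ ≡ true
    otherRow : ∀ (i : Fin m) → toℕ i ≢ 0 → ∃[ j ] (T ⟨ i , j ⟩ ≡ false)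
    noPattern : ∀ (i i' : Fin m) (k k' : Fin n) → i ≢ i' → k ≢ k' →
      ¬ (T ⟨ i , k ⟩ ≡ false × T ⟨ i' , k' ⟩ ≡ false ×
         T ⟨ i , k' ⟩ ≡ true × T ⟨ i' , k ⟩ ≡ true)

Leftmost : ∀ {m n} → Tableau m n → Fin m → Fin n → Set
Leftmost P i j = P ⟨ i , j ⟩ ≡ true × (∀ k → k < j → P ⟨ i , k ⟩ ≡ false)

Rightmost : ∀ {m n} → Tableau m n → Fin m → Fin n → Set
Rightmost P i j = P ⟨ i , j ⟩ ≡ true × (∀ k → j < k → P ⟨ i , k ⟩ ≡ false)

Topmost : ∀ {m n} → Tableau m n → Fin n → Fin m → Set
Topmost P j i = P ⟨ i , j ⟩ ≡ true × (∀ k → k < i → P ⟨ k , j ⟩ ≡ false)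

record IsParallelogram {m n : ℕ} (P : Tableau m n) : Set where
  field
    firstCell : ∀ (i : Fin m) (j : Fin n) → toℕ i ≡ 0 → toℕ j ≡ 0 → P ⟨ i , j ⟩ ≡ true
    lastCell  : ∀ (i : Fin m) (j : Fin n) → suc (toℕ i) ≡ m → suc (toℕ j) ≡ n →
                P ⟨ i , j ⟩ ≡ true
    rowNonempty : ∀ (i : Fin m) → ∃[ j ] (P ⟨ i , j ⟩ ≡ true)
    rowContiguous : ∀ (i : Fin m) (j k l : Fin n) → j ≤ k → k ≤ l →
                    P ⟨ i , j ⟩ ≡ true → P ⟨ i , l ⟩ ≡ true → P ⟨ i , k ⟩ ≡ true
    consecutiveRows : ∀ (i i' : Fin m) → suc (toℕ i) ≡ toℕ i' →
      ∀ (a b a' b' : Fin n) →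
      Leftmost P i a → Rightmost P i b → Leftmost P i' a' → Rightmost P i' b' →
      (a ≤ a' × a' ≤ b × b ≤ b')

ones : ∀ {m n} → Tableau m n → ℕ
ones T = V.sum (map (countB true) T)

IsRibbon : ∀ {m n} → Tableau m n → Set
IsRibbon {m} {n} P = IsParallelogram P × ones P ≡ m + n ∸ 1

-- Labelled ribbon parallelogram polyominoes.
-- A label v_k is represented by the natural number k.
-- A labelled object is (P , row labels , column labels).

Labelled : ℕ → ℕ → Set
Labelled m n = Tableau m n × Vec ℕ m × Vec ℕ n

record IsLRib {m n : ℕ} (L : Labelled m n) : Set where
  P  = proj₁ L
  rl = proj₁ (proj₂ L)
  cl = proj₂ (proj₂ L)
  field
    ribbon   : IsRibbon P
    rowPerm  : toList rl ↭ upTo m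
    rowFirst : ∀ (i : Fin m) → toℕ i ≡ 0 → lookup rl i ≡ 0
    rowIncr  : ∀ (i i' : Fin m) (j : Fin n) → i < i' →
               Leftmost P i j → Leftmost P i' j → lookup rl i N.< lookup rl i'
    colPerm  : toList cl ↭ L.map (m +_) (upTo n)
    colIncr  : ∀ (j j' : Fin n) (i : Fin m) → j < j' →
               Topmost P j i → Topmost P j' i → lookup cl j N.< lookup cl j'

-- Stable sort in weakly decreasing order of a key: elements with equal
-- key keep their original relative order.
module _ {A : Set} (key : A → ℕ) where
  insertDesc : ∀ {k} → A → Vec A k → Vec A (suc k)
  insertDesc x [] = x ∷ []
  insertDesc x (y ∷ ys) =
    if key y ≤ᵇ key x then x ∷ y ∷ ys else y ∷ insertDesc x ys

  sortDesc : ∀ {k} → Vec A k → Vec A k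
  sortDesc [] = []
  sortDesc (x ∷ xs) = insertDesc x (sortDesc xs)

-- Step (1): permute columns (with labels v_{m+j}) so that zeros come first
-- in each row: columns sorted by decreasing number of zeros; ties
-- (which for EW-tableaux are identical columns) keep increasing label order.
step1 : ∀ {m n} → Tableau m n → Tableau m n × Vec ℕ n
step1 {m} {n} T = T₁ , map proj₁ sorted
  where
  cols : Vec (ℕ × Vec Bool m) n
  cols = tabulate (λ j → (m + toℕ j) , map (λ r → lookup r j) T)
  sorted : Vec (ℕ × Vec Bool m) n
  sorted = sortDesc (λ c → countB false (proj₂ c)) cols
  T₁ : Tableau m n
  T₁ = tabulate (λ i → map (λ c → lookup (proj₂ c) i) sorted)

-- Step (2): permute rows (with labels v_i) so that ones come first in each
-- column: rows sorted by decreasing number of ones; ties (identical rows)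
-- keep increasing label order.
step2 : ∀ {m n} → Tableau m n → Tableau m n × Vec ℕ m
step2 {m} {n} T = map proj₂ sorted , map proj₁ sorted
  where
  rows : Vec (ℕ × Vec Bool n) m
  rows = tabulate (λ i → toℕ i , lookup T i)
  sorted : Vec (ℕ × Vec Bool n) m
  sorted = sortDesc (λ r → countB true (proj₂ r)) rows

getV : ∀ {A : Set} {k} → Vec A k → ℕ → Maybe A
getV [] _ = nothing
getV (x ∷ xs) zero = just x
getV (x ∷ xs) (suc i) = getV xs i

step3 : ∀ {m n} → Tableau m n → Tableau m n
step3 {m} {n} T' = tabulate λ i → tabulate λ j → cell i j
  where
  cell : Fin m → Fin n → Bool
  cell i j =
    let t = T' ⟨ i , j ⟩
        lastRow = suc (toℕ i) ≡ᵇ m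
        lastCol = suc (toℕ j) ≡ᵇ n
        below = maybe (λ r → maybe (λ b → b) false (getV r (toℕ j)))
                      false (getV T' (suc (toℕ i)))
        right = maybe (λ b → b) false (getV (lookup T' i) (suc (toℕ j)))
    in (t ∧ (lastRow ∨ not below)) ∨ (not t ∧ (lastCol ∨ right))

φ : ∀ {m n} → Tableau m n → Labelled m n
φ T =
  let (T₁ , cl) = step1 T
      (T' , rl) = step2 T₁
  in step3 T' , rl , cl

module Submission where

-- For an EW-tableau the zero sets of any two columns are nested (this is exactly the
-- forbidden 2 × 2 pattern), so after sorting columns by their number of zeros and rows by
-- their number of ones the tableau T′ is a staircase: row i is 0 up to column z i and 1
-- from there on, with z weakly increasing, z 0 = 0 (the full top row) and z i ≥ 1 below it.
-- Step (3) draws the boundary of this staircase, a ribbon whose row i occupies the columns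
-- z i - 1, …, z (i + 1) - 1; conversely every ribbon, having m + n - 1 cells, has rows that
-- overlap in exactly one column and so arises from exactly one threshold sequence z.
-- Both sorts are stable with labels increasing along the input, so their outputs are the
-- unique arrangements ordered by (key, label); ties are identical rows (columns) of T′,
-- which are exactly the rows (columns) of the ribbon starting in the same column (row) —
-- the situation in which LRib asks labels to increase. Hence φ (T) determines T, and any
-- labelled ribbon is φ of the tableau placing row v_a and column v_{m+b} of its staircase
-- at (a , b).

open import Defs
open import Data.Bool using (Bool; true; false; not; _∧_; _∨_; if_then_else_)
open import Data.Bool.Properties using (¬-not; ∨-identityʳ; ∨-zeroʳ; T-≡)
open import Data.Nat as N using (ℕ; zero; suc; _+_; _∸_; _≤_; _<_; _≤ᵇ_; _≡ᵇ_; z≤n; s≤s)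
open import Data.Nat.Properties
open import Data.Nat.Tactic.RingSolver using (solve-∀)
open import Data.Fin as F using (Fin; toℕ; fromℕ<)
import Data.Fin.Properties as FP
open import Data.Vec as V using (Vec; []; _∷_; lookup; tabulate; toList)
import Data.Vec.Properties as VP
import Data.Vec.Relation.Unary.Any as VAny
open import Data.Vec.Relation.Unary.Any.Properties using (lookup-index)
open import Data.Vec.Membership.Propositional.Properties using (∈-lookup; ∈-toList⁺; ∈-toList⁻)
open import Data.List as L using (List)
import Data.List.Properties as LP
open import Data.List.Relation.Unary.All as All using (All)
open import Data.List.Relation.Unary.Any using (here; there)
open import Data.List.Relation.Unary.AllPairs as AllPairs using (AllPairs)
open import Data.List.Relation.Unary.Unique.Propositional using (Unique)
import Data.List.Relation.Unary.Unique.Propositional.Properties as Unique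
open import Data.List.Membership.Propositional using (_∈_)
open import Data.List.Membership.Propositional.Properties using (∈-applyUpTo⁺; ∈-applyUpTo⁻)
open import Data.List.Relation.Binary.Permutation.Propositional as ↭
  using (_↭_; prep; swap; ↭-sym; ↭-refl; ↭-trans; ↭⇒↭ₛ)
open import Data.List.Relation.Binary.Permutation.Propositional.Properties
  using (All-resp-↭; ∈-resp-↭; drop-∷; ↭-length; map⁺)
import Data.List.Relation.Binary.Permutation.Setoid.Properties as ↭ₛ
open import Data.Maybe using (just; nothing; maybe)
open import Data.Product using (∃-syntax; _×_; _,_; proj₁; proj₂)
open import Data.Sum using (_⊎_; inj₁; inj₂)
open import Data.Empty using (⊥; ⊥-elim)
open import Function using (id; _∘_; Equivalence)
open import Relation.Binary using (Tri; tri<; tri≈; tri>)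
open import Relation.Binary.PropositionalEquality
open import Relation.Nullary using (¬_; Dec; yes; no)

≡true⇒≢false : ∀ {a : Bool} → a ≡ true → a ≢ false
≡true⇒≢false refl ()

≡true-ext : ∀ {a b : Bool} → (a ≡ true → b ≡ true) → (b ≡ true → a ≡ true) → a ≡ b
≡true-ext {false} {false} _ _ = refl
≡true-ext {false} {true}  _ g = g refl
≡true-ext {true}  {false} f _ = sym (f refl)
≡true-ext {true}  {true}  _ _ = refl

≤⇒≤ᵇ≡true : ∀ {a b} → a ≤ b → (a ≤ᵇ b) ≡ true
≤⇒≤ᵇ≡true h = Equivalence.to T-≡ (≤⇒≤ᵇ h)

≤ᵇ≡true⇒≤ : ∀ {a b} → (a ≤ᵇ b) ≡ true → a ≤ b
≤ᵇ≡true⇒≤ {a} {b} e = ≤ᵇ⇒≤ a b (Equivalence.from T-≡ e)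

≰⇒≤ᵇ≡false : ∀ {a b} → ¬ a ≤ b → (a ≤ᵇ b) ≡ false
≰⇒≤ᵇ≡false h = ¬-not (h ∘ ≤ᵇ≡true⇒≤)

not-≤ᵇ : ∀ a b → not (a ≤ᵇ b) ≡ (suc b ≤ᵇ a)
not-≤ᵇ a b with a ≤? b
... | yes a≤b rewrite ≤⇒≤ᵇ≡true a≤b = sym (≰⇒≤ᵇ≡false (≤⇒≯ a≤b))
... | no a≰b rewrite ≰⇒≤ᵇ≡false a≰b = sym (≤⇒≤ᵇ≡true (≰⇒> a≰b))

≡⇒≡ᵇ≡true : ∀ {a b} → a ≡ b → (a ≡ᵇ b) ≡ true
≡⇒≡ᵇ≡true {a} {b} e = Equivalence.to T-≡ (≡⇒≡ᵇ a b e)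

≢⇒≡ᵇ≡false : ∀ {a b} → a ≢ b → (a ≡ᵇ b) ≡ false
≢⇒≡ᵇ≡false {a} {b} h = ¬-not (h ∘ ≡ᵇ⇒≡ a b ∘ Equivalence.from T-≡)

vec-ext : ∀ {A : Set} {k} {u v : Vec A k} → (∀ i → lookup u i ≡ lookup v i) → u ≡ v
vec-ext {u = u} {v} h =
  trans (sym (VP.tabulate∘lookup u)) (trans (VP.tabulate-cong h) (VP.tabulate∘lookup v))

lookup∘tabulate² : ∀ {A : Set} {m n} (f : Fin m → Fin n → A) i j →
  lookup (lookup (tabulate (λ i → tabulate (f i))) i) j ≡ f i j
lookup∘tabulate² f i j rewrite VP.lookup∘tabulate (λ i → tabulate (f i)) i = VP.lookup∘tabulate (f i) j

lookup∈toList : ∀ {A : Set} {k} (v : Vec A k) (i : Fin k) → lookup v i ∈ toList v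
lookup∈toList v i = ∈-toList⁺ (∈-lookup i v)

∈toList⇒lookup : ∀ {A : Set} {k} (v : Vec A k) {x : A} → x ∈ toList v → ∃[ i ] (lookup v i ≡ x)
∈toList⇒lookup v x∈v = VAny.index (∈-toList⁻ x∈v) , sym (lookup-index (∈-toList⁻ x∈v))

AllPairs-lookup : ∀ {A : Set} {R : A → A → Set} {k} (v : Vec A k) → AllPairs R (toList v) →
  ∀ (p q : Fin k) → toℕ p < toℕ q → R (lookup v p) (lookup v q)
AllPairs-lookup (x ∷ v) (ax AllPairs.∷ _) F.zero (F.suc q) _ = All.lookup ax (lookup∈toList v q)
AllPairs-lookup (x ∷ v) (_ AllPairs.∷ ap) (F.suc p) (F.suc q) (s≤s h) = AllPairs-lookup v ap p q h

All-tabulate : ∀ {A : Set} {P : A → Set} {k} (f : Fin k → A) → (∀ i → P (f i)) →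
  All P (toList (tabulate f))
All-tabulate {k = zero} f h = All.[]
All-tabulate {k = suc k} f h = h F.zero All.∷ All-tabulate (f ∘ F.suc) (h ∘ F.suc)

AllPairs-tabulate : ∀ {A : Set} {R : A → A → Set} {k} (f : Fin k → A) →
  (∀ p q → toℕ p < toℕ q → R (f p) (f q)) → AllPairs R (toList (tabulate f))
AllPairs-tabulate {k = zero} f h = AllPairs.[]
AllPairs-tabulate {k = suc k} f h =
  All-tabulate (f ∘ F.suc) (λ i → h F.zero (F.suc i) (s≤s z≤n)) AllPairs.∷
  AllPairs-tabulate (f ∘ F.suc) (λ p q pq → h (F.suc p) (F.suc q) (s≤s pq))

AllPairs-lookup⁻ : ∀ {A : Set} {R : A → A → Set} {k} (v : Vec A k) →
  (∀ (p q : Fin k) → toℕ p < toℕ q → R (lookup v p) (lookup v q)) → AllPairs R (toList v)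
AllPairs-lookup⁻ v h =
  subst (λ w → AllPairs _ (toList w)) (VP.tabulate∘lookup v) (AllPairs-tabulate (lookup v) h)

toList-injective : ∀ {A : Set} {k} (u v : Vec A k) → toList u ≡ toList v → u ≡ v
toList-injective [] [] _ = refl
toList-injective (x ∷ u) (y ∷ v) e = cong₂ _∷_ (LP.∷-injectiveˡ e) (toList-injective u v (LP.∷-injectiveʳ e))

toList-tabulate-toℕ : ∀ {A : Set} {k} (h : ℕ → A) →
  toList (tabulate {n = k} (h ∘ toℕ)) ≡ L.applyUpTo h k
toList-tabulate-toℕ {k = zero} h = refl
toList-tabulate-toℕ {k = suc k} h = cong (h 0 L.∷_) (toList-tabulate-toℕ {k = k} (h ∘ suc))

map-toList-tabulate : ∀ {A B : Set} {k} (g : A → B) (f : Fin k → A) →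
  L.map g (toList (tabulate f)) ≡ toList (tabulate (g ∘ f))
map-toList-tabulate {k = zero} g f = refl
map-toList-tabulate {k = suc k} g f = cong (g (f F.zero) L.∷_) (map-toList-tabulate g (f ∘ F.suc))

Unique-resp-↭ : ∀ {xs ys : List ℕ} → xs ↭ ys → Unique xs → Unique ys
Unique-resp-↭ p = ↭ₛ.Unique-resp-↭ (setoid ℕ) (↭⇒↭ₛ p)

-- Stable sorting
module StableSort {A : Set} (key label : A → ℕ) where

  -- the order in which sortDesc key emits elements whose labels increase along its input
  _≺_ : A → A → Set
  x ≺ y = key y < key x ⊎ (key y ≡ key x × label x < label y)

  ≺⇒key≥ : ∀ {x y} → x ≺ y → key y ≤ key x
  ≺⇒key≥ (inj₁ h) = <⇒≤ h
  ≺⇒key≥ (inj₂ (e , _)) = ≤-reflexive e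

  ≺-asym : ∀ {x y} → x ≺ y → ¬ y ≺ x
  ≺-asym (inj₁ h) (inj₁ g) = <-asym h g
  ≺-asym (inj₁ h) (inj₂ (e , _)) = <-irrefl (sym e) h
  ≺-asym (inj₂ (e , _)) (inj₁ g) = <-irrefl (sym e) g
  ≺-asym (inj₂ (_ , h)) (inj₂ (_ , g)) = <-asym h g

  ≺-irrefl : ∀ {x} → ¬ x ≺ x
  ≺-irrefl x≺x = ≺-asym x≺x x≺x

  insertDesc-↭ : ∀ {k} (x : A) (ys : Vec A k) → toList (insertDesc key x ys) ↭ x L.∷ toList ys
  insertDesc-↭ x [] = ↭-refl
  insertDesc-↭ x (y ∷ ys) with key y ≤ᵇ key x
  ... | true = ↭-refl
  ... | false = ↭-trans (prep y (insertDesc-↭ x ys)) (swap y x ↭-refl)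

  sortDesc-↭ : ∀ {k} (v : Vec A k) → toList (sortDesc key v) ↭ toList v
  sortDesc-↭ [] = ↭-refl
  sortDesc-↭ (x ∷ v) = ↭-trans (insertDesc-↭ x (sortDesc key v)) (prep x (sortDesc-↭ v))

  ≺-intro : ∀ {x z} → key z ≤ key x → label x < label z → x ≺ z
  ≺-intro le lt with m≤n⇒m<n∨m≡n le
  ... | inj₁ h = inj₁ h
  ... | inj₂ e = inj₂ (e , lt)

  insertDesc-sorted : ∀ {k} (x : A) (ys : Vec A k) → All (λ y → label x < label y) (toList ys) →
    AllPairs _≺_ (toList ys) → AllPairs _≺_ (toList (insertDesc key x ys))
  insertDesc-sorted x [] _ _ = All.[] AllPairs.∷ AllPairs.[]
  insertDesc-sorted x (y ∷ ys) (x<y All.∷ x<ys) (y≺ys AllPairs.∷ ys-sorted) with key y ≤ᵇ key x in eq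
  ... | true = (≺-intro y≤x x<y All.∷ All.zipWith x≺ (y≺ys , x<ys)) AllPairs.∷ y≺ys AllPairs.∷ ys-sorted
    where
    y≤x : key y ≤ key x
    y≤x = ≤ᵇ≡true⇒≤ eq
    x≺ : ∀ {z} → y ≺ z × label x < label z → x ≺ z
    x≺ (y≺z , lt) = ≺-intro (≤-trans (≺⇒key≥ y≺z) y≤x) lt
  ... | false = All-resp-↭ (↭-sym (insertDesc-↭ x ys)) (inj₁ x<y' All.∷ y≺ys) AllPairs.∷
                insertDesc-sorted x ys x<ys ys-sorted
    where
    x<y' : key x < key y
    x<y' = ≰⇒> (λ le → ≡true⇒≢false (≤⇒≤ᵇ≡true le) eq)

  sortDesc-sorted : ∀ {k} (v : Vec A k) → AllPairs (λ x y → label x < label y) (toList v) →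
    AllPairs _≺_ (toList (sortDesc key v))
  sortDesc-sorted [] _ = AllPairs.[]
  sortDesc-sorted (x ∷ v) (x<v AllPairs.∷ v-incr) =
    insertDesc-sorted x (sortDesc key v) (All-resp-↭ (↭-sym (sortDesc-↭ v)) x<v) (sortDesc-sorted v v-incr)

  ≺-sorted-unique : ∀ {xs ys : List A} → xs ↭ ys → AllPairs _≺_ xs → AllPairs _≺_ ys → xs ≡ ys
  ≺-sorted-unique {L.[]} {L.[]} _ _ _ = refl
  ≺-sorted-unique {L.[]} {_ L.∷ _} p _ _ with ↭-length p
  ... | ()
  ≺-sorted-unique {_ L.∷ _} {L.[]} p _ _ with ↭-length p
  ... | ()
  ≺-sorted-unique {x L.∷ xs} {y L.∷ ys} p (x≺xs AllPairs.∷ sx) (y≺ys AllPairs.∷ sy)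
    with ∈-resp-↭ p (here refl)
  ... | here refl = cong (x L.∷_) (≺-sorted-unique (drop-∷ p) sx sy)
  ... | there x∈ys with ∈-resp-↭ (↭-sym p) (here refl)
  ...   | here refl = ⊥-elim (≺-irrefl (All.lookup y≺ys x∈ys))
  ...   | there y∈xs = ⊥-elim (≺-asym (All.lookup y≺ys x∈ys) (All.lookup x≺xs y∈xs))

-- Counting entries
countB-≡ : ∀ {k} b x (xs : Vec Bool k) → x ≡ b → countB b (x ∷ xs) ≡ suc (countB b xs)
countB-≡ true true _ _ = refl
countB-≡ false false _ _ = refl

countB-≢ : ∀ {k} b x (xs : Vec Bool k) → x ≢ b → countB b (x ∷ xs) ≡ countB b xs
countB-≢ true true _ h = ⊥-elim (h refl)
countB-≢ false false _ h = ⊥-elim (h refl)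
countB-≢ true false _ _ = refl
countB-≢ false true _ _ = refl

countB≤length : ∀ {k} b (v : Vec Bool k) → countB b v ≤ k
countB≤length b [] = z≤n
countB≤length b (x ∷ v) with x Data.Bool.≟ b
... | yes e = subst (_≤ suc _) (sym (countB-≡ b x v e)) (s≤s (countB≤length b v))
... | no e = subst (_≤ suc _) (sym (countB-≢ b x v e)) (m≤n⇒m≤1+n (countB≤length b v))

countB-all : ∀ {k} b (v : Vec Bool k) → (∀ i → lookup v i ≡ b) → countB b v ≡ k
countB-all b [] h = refl
countB-all b (x ∷ v) h = trans (countB-≡ b x v (h F.zero)) (cong suc (countB-all b v (h ∘ F.suc)))

countB-none : ∀ {k} b (v : Vec Bool k) → (∀ i → lookup v i ≢ b) → countB b v ≡ 0
countB-none b [] h = refl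
countB-none b (x ∷ v) h = trans (countB-≢ b x v (h F.zero)) (countB-none b v (h ∘ F.suc))

_⊆⟨_⟩_ : ∀ {k} → Vec Bool k → Bool → Vec Bool k → Set
v ⊆⟨ b ⟩ u = ∀ q → lookup v q ≡ b → lookup u q ≡ b

countB-mono : ∀ {k} b (u v : Vec Bool k) → v ⊆⟨ b ⟩ u → countB b v ≤ countB b u
countB-mono b [] [] _ = z≤n
countB-mono b (x ∷ u) (y ∷ v) v⊆u with y Data.Bool.≟ b | x Data.Bool.≟ b
... | yes y≡b | _ = subst₂ _≤_ (sym (countB-≡ b y v y≡b)) (sym (countB-≡ b x u (v⊆u F.zero y≡b)))
                      (s≤s (countB-mono b u v (v⊆u ∘ F.suc)))
... | no y≢b | yes x≡b = subst₂ _≤_ (sym (countB-≢ b y v y≢b)) (sym (countB-≡ b x u x≡b))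
                           (m≤n⇒m≤1+n (countB-mono b u v (v⊆u ∘ F.suc)))
... | no y≢b | no x≢b = subst₂ _≤_ (sym (countB-≢ b y v y≢b)) (sym (countB-≢ b x u x≢b))
                          (countB-mono b u v (v⊆u ∘ F.suc))

countB-mono-< : ∀ {k} b (u v : Vec Bool k) → v ⊆⟨ b ⟩ u →
  ∀ p → lookup u p ≡ b → lookup v p ≢ b → countB b v < countB b u
countB-mono-< b (x ∷ u) (y ∷ v) v⊆u F.zero x≡b y≢b =
  subst₂ _<_ (sym (countB-≢ b y v y≢b)) (sym (countB-≡ b x u x≡b)) (s≤s (countB-mono b u v (v⊆u ∘ F.suc)))
countB-mono-< b (x ∷ u) (y ∷ v) v⊆u (F.suc p) up vp with y Data.Bool.≟ b | x Data.Bool.≟ b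
... | yes y≡b | _ = subst₂ _<_ (sym (countB-≡ b y v y≡b)) (sym (countB-≡ b x u (v⊆u F.zero y≡b)))
                      (s≤s (countB-mono-< b u v (v⊆u ∘ F.suc) p up vp))
... | no y≢b | yes x≡b = subst₂ _<_ (sym (countB-≢ b y v y≢b)) (sym (countB-≡ b x u x≡b))
                           (m<n⇒m<1+n (countB-mono-< b u v (v⊆u ∘ F.suc) p up vp))
... | no y≢b | no x≢b = subst₂ _<_ (sym (countB-≢ b y v y≢b)) (sym (countB-≢ b x u x≢b))
                          (countB-mono-< b u v (v⊆u ∘ F.suc) p up vp)

-- The b-positions of u and v are comparable under inclusion, in the negative form the EW condition gives.
Nested : ∀ {k} → Bool → Vec Bool k → Vec Bool k → Set
Nested b u v = ∀ p q → lookup u p ≡ b → lookup v p ≢ b → lookup u q ≢ b → lookup v q ≡ b → ⊥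

nested-countB≤⇒⊆ : ∀ {k} b (u v : Vec Bool k) → Nested b u v → countB b u ≤ countB b v → u ⊆⟨ b ⟩ v
nested-countB≤⇒⊆ b u v nested le p up with lookup v p Data.Bool.≟ b
... | yes vp = vp
... | no vp = ⊥-elim (<⇒≱ (countB-mono-< b u v v⊆u p up vp) le)
  where
  v⊆u : v ⊆⟨ b ⟩ u
  v⊆u q vq with lookup u q Data.Bool.≟ b
  ... | yes uq = uq
  ... | no uq = ⊥-elim (nested p q up vp uq vq)

Monotone : ∀ {k} → Vec Bool k → Set
Monotone {k} v = ∀ (j j' : Fin k) → toℕ j ≤ toℕ j' → lookup v j ≡ true → lookup v j' ≡ true

monotone-true⇔ : ∀ {k} (v : Vec Bool k) → Monotone v → ∀ j →
  (lookup v j ≡ true → countB false v ≤ toℕ j) × (countB false v ≤ toℕ j → lookup v j ≡ true)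
monotone-true⇔ (true ∷ v) mono j =
  (λ _ → subst (_≤ toℕ j) (sym no-zeros) z≤n) , (λ _ → mono F.zero j z≤n refl)
  where
  no-zeros : countB false v ≡ 0
  no-zeros = countB-none false v (λ i → ≡true⇒≢false (mono F.zero (F.suc i) z≤n refl))
monotone-true⇔ (false ∷ v) mono F.zero = (λ ()) , (λ ())
monotone-true⇔ (false ∷ v) mono (F.suc j)
  with monotone-true⇔ v (λ a b ab → mono (F.suc a) (F.suc b) (s≤s ab)) j
... | f , g = (λ e → s≤s (f e)) , (λ { (s≤s le) → g le })

-- Staircases and their boundaries
getV-toℕ : ∀ {A : Set} {k} (v : Vec A k) (i : Fin k) → getV v (toℕ i) ≡ just (lookup v i)
getV-toℕ (x ∷ v) F.zero = refl
getV-toℕ (x ∷ v) (F.suc i) = getV-toℕ v i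

getV-≥ : ∀ {A : Set} {k} (v : Vec A k) (i : ℕ) → k ≤ i → getV v i ≡ nothing
getV-≥ [] i h = refl
getV-≥ (x ∷ v) (suc i) (s≤s h) = getV-≥ v i h

-- the ℕ-indexed reading used by step3, with the junk value false outside the tableau
entry : ∀ {m n} → Tableau m n → ℕ → ℕ → Bool
entry X i j = maybe (λ r → maybe id false (getV r j)) false (getV X i)

entry-toℕ : ∀ {m n} (X : Tableau m n) i j → entry X (toℕ i) (toℕ j) ≡ X ⟨ i , j ⟩
entry-toℕ X i j rewrite getV-toℕ X i | getV-toℕ (lookup X i) j = refl

entry-fromℕ< : ∀ {m n} (X : Tableau m n) i j (i<m : i < m) (j<n : j < n) →
  entry X i j ≡ X ⟨ fromℕ< i<m , fromℕ< j<n ⟩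
entry-fromℕ< X i j i<m j<n =
  subst₂ (λ a b → entry X a b ≡ X ⟨ fromℕ< i<m , fromℕ< j<n ⟩) (FP.toℕ-fromℕ< i<m) (FP.toℕ-fromℕ< j<n)
    (entry-toℕ X (fromℕ< i<m) (fromℕ< j<n))

entry-≥rows : ∀ {m n} (X : Tableau m n) i j → m ≤ i → entry X i j ≡ false
entry-≥rows X i j h rewrite getV-≥ X i h = refl

cellRule : (here below right : Bool) → Bool
cellRule t u w = (t ∧ u) ∨ (not t ∧ w)

step3-⟨⟩ : ∀ {m n} (X : Tableau m n) i j → step3 X ⟨ i , j ⟩ ≡
  cellRule (entry X (toℕ i) (toℕ j)) ((suc (toℕ i) ≡ᵇ m) ∨ not (entry X (suc (toℕ i)) (toℕ j)))
           ((suc (toℕ j) ≡ᵇ n) ∨ entry X (toℕ i) (suc (toℕ j)))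
step3-⟨⟩ X i j rewrite getV-toℕ X i | getV-toℕ (lookup X i) j = lookup∘tabulate² _ i j

-- Within a row of zeros-then-ones starting at a, above a row starting at c, the boundary
-- cell rule marks exactly the columns a - 1, …, c - 1.
cellRule-staircase : ∀ a c j → 1 ≤ c → a ≤ c →
  (cellRule (a ≤ᵇ j) (suc j ≤ᵇ c) (a ≤ᵇ suc j) ≡ true → a ∸ 1 ≤ j × j ≤ c ∸ 1) ×
  (a ∸ 1 ≤ j → j ≤ c ∸ 1 → cellRule (a ≤ᵇ j) (suc j ≤ᵇ c) (a ≤ᵇ suc j) ≡ true)
cellRule-staircase a (suc c) j _ a≤c with a ≤? j
... | yes a≤j rewrite ≤⇒≤ᵇ≡true a≤j | ∨-identityʳ (suc j ≤ᵇ suc c) =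
      (λ e → ≤-trans (m∸n≤m a 1) a≤j , ≤-pred (≤ᵇ≡true⇒≤ e)) ,
      (λ _ j≤c → ≤⇒≤ᵇ≡true (s≤s j≤c))
... | no a≰j rewrite ≰⇒≤ᵇ≡false a≰j =
      (λ e → m≤n+o⇒m∸n≤o a 1 (≤ᵇ≡true⇒≤ e) , ≤-pred (≤-trans (≰⇒> a≰j) a≤c)) ,
      (λ a∸1≤j _ → ≤⇒≤ᵇ≡true (≤-trans (m≤n+m∸n a 1) (s≤s a∸1≤j)))

record IntervalRows {m n : ℕ} (P : Tableau m n) (lo hi : ℕ → ℕ) : Set where
  field
    bounded : ∀ i j → P ⟨ i , j ⟩ ≡ true → lo (toℕ i) ≤ toℕ j × toℕ j ≤ hi (toℕ i)
    filled  : ∀ i j → lo (toℕ i) ≤ toℕ j → toℕ j ≤ hi (toℕ i) → P ⟨ i , j ⟩ ≡ true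
    lo-first : lo 0 ≡ 0
    hi-last  : ∀ i → suc i ≡ m → hi i ≡ n ∸ 1
    lo≤hi : ∀ i → i < m → lo i ≤ hi i
    hi<n  : ∀ i → i < m → hi i < n
    lo-suc : ∀ i → suc i < m → lo (suc i) ≡ hi i

n∸1<n : ∀ c → 1 ≤ c → c ∸ 1 < c
n∸1<n (suc c) _ = ≤-refl

-- X plays the role of the tableau T′ of step (2); z i is the number of zeros of row i.
module Staircase {m n : ℕ} (X : Tableau m n) (z : ℕ → ℕ)
  (true⇒z≤ : ∀ i j → X ⟨ i , j ⟩ ≡ true → z (toℕ i) ≤ toℕ j)
  (z≤⇒true : ∀ i j → z (toℕ i) ≤ toℕ j → X ⟨ i , j ⟩ ≡ true)
  (z-first : z 0 ≡ 0)
  (z-pos : ∀ i → 1 ≤ i → 1 ≤ z i)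
  (z-step : ∀ i → suc i < m → z i ≤ z (suc i))
  (z-beyond : ∀ i → m ≤ i → z i ≡ n)
  (z-bounded : ∀ i → z i ≤ n) where

  entry-z : ∀ i j → j < n → entry X i j ≡ (z i ≤ᵇ j)
  entry-z i j j<n with i <? m
  ... | yes i<m = trans (entry-fromℕ< X i j i<m j<n) (≡true-ext
          (λ e → ≤⇒≤ᵇ≡true (subst₂ _≤_ (cong z (FP.toℕ-fromℕ< i<m)) (FP.toℕ-fromℕ< j<n) (true⇒z≤ _ _ e)))
          (λ e → z≤⇒true _ _ (subst₂ _≤_ (cong z (sym (FP.toℕ-fromℕ< i<m))) (sym (FP.toℕ-fromℕ< j<n))
                                 (≤ᵇ≡true⇒≤ e))))
  ... | no i≮m = trans (entry-≥rows X i j (≮⇒≥ i≮m))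
          (sym (≰⇒≤ᵇ≡false (λ le → <⇒≱ j<n (subst (_≤ j) (z-beyond i (≮⇒≥ i≮m)) le))))

  right-z : ∀ i j → j < n → ((suc j ≡ᵇ n) ∨ entry X i (suc j)) ≡ (z i ≤ᵇ suc j)
  right-z i j j<n with suc j <? n
  ... | yes sj<n rewrite ≢⇒≡ᵇ≡false (<⇒≢ sj<n) = entry-z i (suc j) sj<n
  ... | no sj≮n rewrite ≡⇒≡ᵇ≡true (≤-antisym j<n (≮⇒≥ sj≮n)) =
          sym (≤⇒≤ᵇ≡true (subst (z i ≤_) (sym (≤-antisym j<n (≮⇒≥ sj≮n))) (z-bounded i)))

  below-z : ∀ i j → i < m → j < n → ((suc i ≡ᵇ m) ∨ not (entry X (suc i) j)) ≡ (suc j ≤ᵇ z (suc i))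
  below-z i j i<m j<n with suc i <? m
  ... | yes si<m rewrite ≢⇒≡ᵇ≡false (<⇒≢ si<m) | entry-z (suc i) j j<n = not-≤ᵇ (z (suc i)) j
  ... | no si≮m rewrite ≡⇒≡ᵇ≡true (≤-antisym i<m (≮⇒≥ si≮m)) =
          sym (≤⇒≤ᵇ≡true (subst (suc j ≤_) (sym (z-beyond (suc i) (≮⇒≥ si≮m))) j<n))

  step3-z : ∀ i j → step3 X ⟨ i , j ⟩ ≡
    cellRule (z (toℕ i) ≤ᵇ toℕ j) (suc (toℕ j) ≤ᵇ z (suc (toℕ i))) (z (toℕ i) ≤ᵇ suc (toℕ j))
  step3-z i j rewrite step3-⟨⟩ X i j | entry-z (toℕ i) (toℕ j) (FP.toℕ<n j)
                    | below-z (toℕ i) (toℕ j) (FP.toℕ<n i) (FP.toℕ<n j)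
                    | right-z (toℕ i) (toℕ j) (FP.toℕ<n j) = refl

  z-suc-mono : ∀ i → i < m → z i ≤ z (suc i)
  z-suc-mono i i<m with suc i <? m
  ... | yes si<m = z-step i si<m
  ... | no si≮m = subst (z i ≤_) (sym (z-beyond (suc i) (≮⇒≥ si≮m))) (z-bounded i)

  boundary-cell : ∀ (i : Fin m) (j : Fin n) →
    (step3 X ⟨ i , j ⟩ ≡ true → z (toℕ i) ∸ 1 ≤ toℕ j × toℕ j ≤ z (suc (toℕ i)) ∸ 1) ×
    (z (toℕ i) ∸ 1 ≤ toℕ j → toℕ j ≤ z (suc (toℕ i)) ∸ 1 → step3 X ⟨ i , j ⟩ ≡ true)
  boundary-cell i j rewrite step3-z i j =
    cellRule-staircase (z (toℕ i)) (z (suc (toℕ i))) (toℕ j)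
      (z-pos (suc (toℕ i)) (s≤s z≤n)) (z-suc-mono (toℕ i) (FP.toℕ<n i))

  boundary : IntervalRows (step3 X) (λ i → z i ∸ 1) (λ i → z (suc i) ∸ 1)
  boundary = record
    { bounded = λ i j → proj₁ (boundary-cell i j)
    ; filled = λ i j → proj₂ (boundary-cell i j)
    ; lo-first = cong (_∸ 1) z-first
    ; hi-last = λ i e → cong (_∸ 1) (z-beyond (suc i) (≤-reflexive (sym e)))
    ; lo≤hi = λ i i<m → ∸-monoˡ-≤ 1 (z-suc-mono i i<m)
    ; hi<n = λ i _ → ≤-trans (n∸1<n (z (suc i)) (z-pos (suc i) (s≤s z≤n))) (z-bounded (suc i))
    ; lo-suc = λ _ _ → refl
    }

countB-interval : ∀ {k} (v : Vec Bool k) lo hi →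
  (∀ j → lookup v j ≡ true → lo ≤ toℕ j × toℕ j ≤ hi) →
  (∀ j → lo ≤ toℕ j → toℕ j ≤ hi → lookup v j ≡ true) →
  lo ≤ hi → hi < k → countB true v + lo ≡ suc hi
countB-interval (x ∷ v) zero zero bounded filled _ _ =
  trans (cong (_+ 0) (countB-≡ true x v (filled F.zero z≤n z≤n)))
        (cong (λ c → suc c + 0) (countB-none true v (λ i e → ≤⇒≯ (proj₂ (bounded (F.suc i) e)) (s≤s z≤n))))
countB-interval (x ∷ v) zero (suc hi) bounded filled _ (s≤s hi<k) =
  trans (cong (_+ 0) (countB-≡ true x v (filled F.zero z≤n z≤n)))
        (cong suc (countB-interval v 0 hi (λ j e → z≤n , ≤-pred (proj₂ (bounded (F.suc j) e)))
                                          (λ j _ j≤hi → filled (F.suc j) z≤n (s≤s j≤hi)) z≤n hi<k))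
countB-interval (x ∷ v) (suc lo) (suc hi) bounded filled (s≤s lo≤hi) (s≤s hi<k) =
  trans (cong (_+ suc lo) (countB-≢ true x v (λ e → ≤⇒≯ (proj₁ (bounded F.zero e)) (s≤s z≤n))))
        (trans (+-suc (countB true v) lo)
          (cong suc (countB-interval v lo hi
                       (λ j e → ≤-pred (proj₁ (bounded (F.suc j) e)) , ≤-pred (proj₂ (bounded (F.suc j) e)))
                       (λ j a b → filled (F.suc j) (s≤s a) (s≤s b)) lo≤hi hi<k)))

sumBelow : (ℕ → ℕ) → ℕ → ℕ
sumBelow g zero = 0
sumBelow g (suc k) = g 0 + sumBelow (g ∘ suc) k

sumBelow-zero : ∀ g k → (∀ i → i < k → g i ≡ 0) → sumBelow g k ≡ 0
sumBelow-zero g zero h = refl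
sumBelow-zero g (suc k) h rewrite h 0 (s≤s z≤n) = sumBelow-zero (g ∘ suc) k (λ i i<k → h (suc i) (s≤s i<k))

sumBelow≡0 : ∀ g k → sumBelow g k ≡ 0 → ∀ i → i < k → g i ≡ 0
sumBelow≡0 g (suc k) e zero _ = m+n≡0⇒m≡0 (g 0) e
sumBelow≡0 g (suc k) e (suc i) (s≤s i<k) = sumBelow≡0 (g ∘ suc) k (m+n≡0⇒n≡0 (g 0) e) i i<k

-- Rows occupying [lo i, hi i] with lo (i + 1) ≤ hi i: the count of ones telescopes,
-- each overlap hi i - lo (i + 1) being counted once more.
ones-rows : ∀ {n k} (P : Tableau (suc k) n) (lo hi : ℕ → ℕ) →
  (∀ (i : Fin (suc k)) → countB true (lookup P i) + lo (toℕ i) ≡ suc (hi (toℕ i))) →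
  (∀ i → i < k → lo (suc i) ≤ hi i) →
  ones P + lo 0 ≡ suc (hi k) + k + sumBelow (λ i → hi i ∸ lo (suc i)) k
ones-rows {k = zero} (r ∷ []) lo hi rows _ =
  trans (cong (_+ lo 0) (+-identityʳ (countB true r)))
        (trans (rows F.zero) (sym (trans (+-identityʳ _) (+-identityʳ _))))
ones-rows {k = suc k} (r ∷ P) lo hi rows lo≤hi =
  begin
    (countB true r + ones P) + lo 0
  ≡⟨ swap₂₃ (countB true r) (ones P) (lo 0) ⟩
    (countB true r + lo 0) + ones P
  ≡⟨ cong (_+ ones P) (rows F.zero) ⟩
    suc (hi 0) + ones P
  ≡⟨ cong (λ w → suc w + ones P) (sym (m+[n∸m]≡n (lo≤hi 0 (s≤s z≤n)))) ⟩
    suc (lo 1 + (hi 0 ∸ lo 1)) + ones P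
  ≡⟨ shuffle₁ (lo 1) (hi 0 ∸ lo 1) (ones P) ⟩
    suc ((hi 0 ∸ lo 1) + (ones P + lo 1))
  ≡⟨ cong (λ w → suc ((hi 0 ∸ lo 1) + w))
       (ones-rows P (lo ∘ suc) (hi ∘ suc) (rows ∘ F.suc) (λ i i<k → lo≤hi (suc i) (s≤s i<k))) ⟩
    suc ((hi 0 ∸ lo 1) + (suc (hi (suc k)) + k + sumBelow (λ i → hi (suc i) ∸ lo (suc (suc i))) k))
  ≡⟨ shuffle₂ (hi 0 ∸ lo 1) (suc (hi (suc k))) k _ ⟩
    suc (hi (suc k)) + suc k + sumBelow (λ i → hi i ∸ lo (suc i)) (suc k)
  ∎
  where
  open ≡-Reasoning
  swap₂₃ : ∀ (c o l : ℕ) → (c + o) + l ≡ (c + l) + o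
  swap₂₃ = solve-∀
  shuffle₁ : ∀ (l g o : ℕ) → suc (l + g) + o ≡ suc (g + (o + l))
  shuffle₁ = solve-∀
  shuffle₂ : ∀ (g s k t : ℕ) → suc (g + (s + k + t)) ≡ s + suc k + (g + t)
  shuffle₂ = solve-∀

module IntervalRowsProperties {m n : ℕ} {P : Tableau m n} {lo hi : ℕ → ℕ} (rows : IntervalRows P lo hi) where
  open IntervalRows rows

  lo<n : ∀ i → i < m → lo i < n
  lo<n i i<m = ≤-<-trans (lo≤hi i i<m) (hi<n i i<m)

  leftmost : ∀ i → Leftmost P i (fromℕ< (lo<n (toℕ i) (FP.toℕ<n i)))
  leftmost i = filled i _ (≤-reflexive (sym a≡)) (≤-trans (≤-reflexive a≡) (lo≤hi (toℕ i) (FP.toℕ<n i))) ,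
               (λ k k<a → ¬-not (λ e → <⇒≱ (subst (toℕ k <_) a≡ k<a) (proj₁ (bounded i k e))))
    where
    a≡ : toℕ (fromℕ< (lo<n (toℕ i) (FP.toℕ<n i))) ≡ lo (toℕ i)
    a≡ = FP.toℕ-fromℕ< (lo<n (toℕ i) (FP.toℕ<n i))

  rightmost : ∀ i → Rightmost P i (fromℕ< (hi<n (toℕ i) (FP.toℕ<n i)))
  rightmost i = filled i _ (≤-trans (lo≤hi (toℕ i) (FP.toℕ<n i)) (≤-reflexive (sym b≡))) (≤-reflexive b≡) ,
                (λ k b<k → ¬-not (λ e → <⇒≱ (subst (_< toℕ k) b≡ b<k) (proj₂ (bounded i k e))))
    where
    b≡ : toℕ (fromℕ< (hi<n (toℕ i) (FP.toℕ<n i))) ≡ hi (toℕ i)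
    b≡ = FP.toℕ-fromℕ< (hi<n (toℕ i) (FP.toℕ<n i))

  leftmost-toℕ : ∀ i a → Leftmost P i a → toℕ a ≡ lo (toℕ i)
  leftmost-toℕ i a (pa , left) with <-cmp (toℕ a) (toℕ (fromℕ< (lo<n (toℕ i) (FP.toℕ<n i))))
  ... | tri< a<a' _ _ = ⊥-elim (<⇒≱ (subst (toℕ a <_) (FP.toℕ-fromℕ< _) a<a') (proj₁ (bounded i a pa)))
  ... | tri≈ _ a≡a' _ = trans a≡a' (FP.toℕ-fromℕ< _)
  ... | tri> _ _ a'<a = ⊥-elim (≡true⇒≢false (proj₁ (leftmost i)) (left _ a'<a))

  rightmost-toℕ : ∀ i b → Rightmost P i b → toℕ b ≡ hi (toℕ i)
  rightmost-toℕ i b (pb , right) with <-cmp (toℕ b) (toℕ (fromℕ< (hi<n (toℕ i) (FP.toℕ<n i))))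
  ... | tri< b<b' _ _ = ⊥-elim (≡true⇒≢false (proj₁ (rightmost i)) (right _ b<b'))
  ... | tri≈ _ b≡b' _ = trans b≡b' (FP.toℕ-fromℕ< _)
  ... | tri> _ _ b'<b = ⊥-elim (<⇒≱ (subst (_< toℕ b) (FP.toℕ-fromℕ< _) b'<b) (proj₂ (bounded i b pb)))

  lo-suc-mono : ∀ i → suc i < m → lo i ≤ lo (suc i)
  lo-suc-mono i si<m = subst (lo i ≤_) (sym (lo-suc i si<m)) (lo≤hi i (<-trans (n<1+n i) si<m))

  lo-mono : ∀ a b → a ≤ b → b < m → lo a ≤ lo b
  lo-mono a b a≤b b<m with m≤n⇒m<n∨m≡n a≤b
  ... | inj₂ refl = ≤-refl
  ... | inj₁ a<b with b
  ...   | suc b' = ≤-trans (lo-mono a b' (≤-pred a<b) (<-trans (n<1+n b') b<m)) (lo-suc-mono b' b<m)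

  isParallelogram : IsParallelogram P
  isParallelogram = record
    { firstCell = λ i j i≡0 j≡0 → filled i j (subst (_≤ toℕ j) (sym (trans (cong lo i≡0) lo-first)) z≤n)
                                              (subst (_≤ hi (toℕ i)) (sym j≡0) z≤n)
    ; lastCell = λ i j i-last j-last →
        let j≡ = trans (trans (cong N.pred j-last) (pred≡∸1 n)) (sym (hi-last (toℕ i) i-last)) in
        filled i j (≤-trans (lo≤hi (toℕ i) (FP.toℕ<n i)) (≤-reflexive (sym j≡))) (≤-reflexive j≡)
    ; rowNonempty = λ i → _ , proj₁ (leftmost i)
    ; rowContiguous = λ i j k l j≤k k≤l pj pl →
        filled i k (≤-trans (proj₁ (bounded i j pj)) j≤k) (≤-trans k≤l (proj₂ (bounded i l pl)))
    ; consecutiveRows = consecutive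
    }
    where
    pred≡∸1 : ∀ c → N.pred c ≡ c ∸ 1
    pred≡∸1 zero = refl
    pred≡∸1 (suc c) = refl
    consecutive : ∀ (i i' : Fin m) → suc (toℕ i) ≡ toℕ i' → ∀ (a b a' b' : Fin n) →
      Leftmost P i a → Rightmost P i b → Leftmost P i' a' → Rightmost P i' b' →
      (toℕ a ≤ toℕ a' × toℕ a' ≤ toℕ b × toℕ b ≤ toℕ b')
    consecutive i i' i'≡ a b a' b' la rb la' rb'
      rewrite leftmost-toℕ i a la | rightmost-toℕ i b rb | leftmost-toℕ i' a' la' | rightmost-toℕ i' b' rb'
            | sym i'≡ | lo-suc (toℕ i) (subst (_< m) (sym i'≡) (FP.toℕ<n i')) =
      lo≤hi (toℕ i) (FP.toℕ<n i) , ≤-refl ,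
      subst (_≤ hi (suc (toℕ i))) (lo-suc (toℕ i) (subst (_< m) (sym i'≡) (FP.toℕ<n i')))
        (lo≤hi (suc (toℕ i)) (subst (_< m) (sym i'≡) (FP.toℕ<n i')))

  lo<topmost-column : ∀ j t → Topmost P j t → ∀ i → 1 ≤ i → i ≤ toℕ t → lo i < toℕ j
  lo<topmost-column j t (pt , above) (suc k) _ sk≤t = ≰⇒> j≰lo
    where
    k<m : k < m
    k<m = <-≤-trans (s≤s ≤-refl) (≤-trans sk≤t (<⇒≤ (FP.toℕ<n t)))
    k≡ : toℕ (fromℕ< k<m) ≡ k
    k≡ = FP.toℕ-fromℕ< k<m
    j≰lo : toℕ j ≤ lo (suc k) → ⊥
    j≰lo j≤lo = ≡true⇒≢false
      (filled (fromℕ< k<m) j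
        (subst (λ w → lo w ≤ toℕ j) (sym k≡)
          (≤-trans (lo-mono k (toℕ t) (≤-trans (n≤1+n k) sk≤t) (FP.toℕ<n t)) (proj₁ (bounded t j pt))))
        (subst (λ w → toℕ j ≤ hi w) (sym k≡)
          (subst (toℕ j ≤_) (lo-suc k (≤-<-trans sk≤t (FP.toℕ<n t))) j≤lo)))
      (above (fromℕ< k<m) (subst (_< toℕ t) (sym k≡) sk≤t))

  topmost-column≤lo : ∀ j t → Topmost P j t → ∀ i → toℕ t < i → i < m → toℕ j ≤ lo i
  topmost-column≤lo j t (pt , _) i t<i i<m =
    ≤-trans (proj₂ (bounded t j pt))
      (≤-trans (≤-reflexive (sym (lo-suc (toℕ t) (≤-<-trans t<i i<m)))) (lo-mono (suc (toℕ t)) i t<i i<m))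

ones-intervalRows : ∀ {k l} {P : Tableau (suc k) (suc l)} {lo hi} → IntervalRows P lo hi →
  ones P ≡ suc k + suc l ∸ 1
ones-intervalRows {k} {l} {P} {lo} {hi} rows =
  begin
    ones P
  ≡⟨ sym (trans (cong (ones P +_) lo-first) (+-identityʳ (ones P))) ⟩
    ones P + lo 0
  ≡⟨ ones-rows P lo hi row-count (λ i i<k → ≤-reflexive (lo-suc i (s≤s i<k))) ⟩
    suc (hi k) + k + sumBelow (λ i → hi i ∸ lo (suc i)) k
  ≡⟨ cong₂ (λ a b → suc a + k + b) (hi-last k refl)
       (sumBelow-zero _ k (λ i i<k → trans (cong (hi i ∸_) (lo-suc i (s≤s i<k))) (n∸n≡0 (hi i)))) ⟩
    suc l + k + 0
  ≡⟨ trans (+-identityʳ _) (trans (cong suc (+-comm l k)) (sym (+-suc k l))) ⟩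
    suc k + suc l ∸ 1
  ∎
  where
  open ≡-Reasoning
  open IntervalRows rows
  row-count : ∀ (i : Fin (suc k)) → countB true (lookup P i) + lo (toℕ i) ≡ suc (hi (toℕ i))
  row-count i = countB-interval (lookup P i) (lo (toℕ i)) (hi (toℕ i)) (bounded i) (filled i)
                  (lo≤hi (toℕ i) (FP.toℕ<n i)) (hi<n (toℕ i) (FP.toℕ<n i))

intervalRows⇒ribbon : ∀ {k l} {P : Tableau (suc k) (suc l)} {lo hi} → IntervalRows P lo hi → IsRibbon P
intervalRows⇒ribbon rows = IntervalRowsProperties.isParallelogram rows , ones-intervalRows rows

-- Ribbons
firstTrue : ∀ {k} → Vec Bool k → ℕ
firstTrue [] = 0
firstTrue (true ∷ v) = 0
firstTrue (false ∷ v) = suc (firstTrue v)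

firstTrue≤ : ∀ {k} (v : Vec Bool k) j → lookup v j ≡ true → firstTrue v ≤ toℕ j
firstTrue≤ (true ∷ v) j e = z≤n
firstTrue≤ (false ∷ v) (F.suc j) e = s≤s (firstTrue≤ v j e)

firstTrue-true : ∀ {k} (v : Vec Bool k) (p : firstTrue v < k) → lookup v (fromℕ< p) ≡ true
firstTrue-true (true ∷ v) p = refl
firstTrue-true (false ∷ v) (s≤s p) = firstTrue-true v p

anyTrue : ∀ {k} → Vec Bool k → Bool
anyTrue [] = false
anyTrue (x ∷ v) = x ∨ anyTrue v

anyTrue-intro : ∀ {k} (v : Vec Bool k) j → lookup v j ≡ true → anyTrue v ≡ true
anyTrue-intro (x ∷ v) F.zero refl = refl
anyTrue-intro (x ∷ v) (F.suc j) e rewrite anyTrue-intro v j e = ∨-zeroʳ x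

anyTrue-elim : ∀ {k} (v : Vec Bool k) → anyTrue v ≡ true → ∃[ j ] (lookup v j ≡ true)
anyTrue-elim (true ∷ v) e = F.zero , refl
anyTrue-elim (false ∷ v) e with anyTrue-elim v e
... | j , ej = F.suc j , ej

lastTrue : ∀ {k} → Vec Bool k → ℕ
lastTrue [] = 0
lastTrue (x ∷ v) = if anyTrue v then suc (lastTrue v) else 0

≤lastTrue : ∀ {k} (v : Vec Bool k) j → lookup v j ≡ true → toℕ j ≤ lastTrue v
≤lastTrue (x ∷ v) F.zero e = z≤n
≤lastTrue (x ∷ v) (F.suc j) e rewrite anyTrue-intro v j e = s≤s (≤lastTrue v j e)

lastTrue< : ∀ {k} (v : Vec Bool k) j → lookup v j ≡ true → lastTrue v < k
lastTrue< (x ∷ v) j e with anyTrue v in eq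
... | false = s≤s z≤n
... | true with anyTrue-elim v eq
...   | j' , e' = s≤s (lastTrue< v j' e')

lastTrue-true : ∀ {k} (v : Vec Bool k) j → lookup v j ≡ true → (p : lastTrue v < k) →
  lookup v (fromℕ< p) ≡ true
lastTrue-true (x ∷ v) j e p with anyTrue v in eq
lastTrue-true (x ∷ v) F.zero e p | false = e
lastTrue-true (x ∷ v) (F.suc j) e p | false = ⊥-elim (≡true⇒≢false (anyTrue-intro v j e) eq)
lastTrue-true (x ∷ v) j e (s≤s p) | true with anyTrue-elim v eq
... | j' , e' = lastTrue-true v j' e' p

module RibbonRows {k l : ℕ} (P : Tableau (suc k) (suc l)) (ribbon : IsRibbon P) where
  open IsParallelogram (proj₁ ribbon)

  lo : ℕ → ℕ
  lo i = maybe firstTrue 0 (getV P i)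

  hi : ℕ → ℕ
  hi i = maybe lastTrue 0 (getV P i)

  lo-toℕ : ∀ i → lo (toℕ i) ≡ firstTrue (lookup P i)
  lo-toℕ i rewrite getV-toℕ P i = refl

  hi-toℕ : ∀ i → hi (toℕ i) ≡ lastTrue (lookup P i)
  hi-toℕ i rewrite getV-toℕ P i = refl

  lo<n : ∀ i → lo (toℕ i) < suc l
  lo<n i = subst (_< suc l) (sym (lo-toℕ i))
             (≤-<-trans (firstTrue≤ (lookup P i) _ (proj₂ (rowNonempty i))) (FP.toℕ<n (proj₁ (rowNonempty i))))

  hi<n : ∀ i → hi (toℕ i) < suc l
  hi<n i = subst (_< suc l) (sym (hi-toℕ i)) (lastTrue< (lookup P i) _ (proj₂ (rowNonempty i)))

  first : Fin (suc k) → Fin (suc l)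
  first i = fromℕ< (lo<n i)

  last : Fin (suc k) → Fin (suc l)
  last i = fromℕ< (hi<n i)

  first-true : ∀ i → P ⟨ i , first i ⟩ ≡ true
  first-true i = trans (cong (lookup (lookup P i)) (FP.fromℕ<-cong _ _ (lo-toℕ i) (lo<n i) p))
                       (firstTrue-true (lookup P i) p)
    where
    p : firstTrue (lookup P i) < suc l
    p = subst (_< suc l) (lo-toℕ i) (lo<n i)

  last-true : ∀ i → P ⟨ i , last i ⟩ ≡ true
  last-true i = trans (cong (lookup (lookup P i)) (FP.fromℕ<-cong _ _ (hi-toℕ i) (hi<n i) p))
                      (lastTrue-true (lookup P i) _ (proj₂ (rowNonempty i)) p)
    where
    p : lastTrue (lookup P i) < suc l
    p = subst (_< suc l) (hi-toℕ i) (hi<n i)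

  bounded : ∀ i j → P ⟨ i , j ⟩ ≡ true → lo (toℕ i) ≤ toℕ j × toℕ j ≤ hi (toℕ i)
  bounded i j e = subst (_≤ toℕ j) (sym (lo-toℕ i)) (firstTrue≤ (lookup P i) j e) ,
                  subst (toℕ j ≤_) (sym (hi-toℕ i)) (≤lastTrue (lookup P i) j e)

  filled : ∀ i j → lo (toℕ i) ≤ toℕ j → toℕ j ≤ hi (toℕ i) → P ⟨ i , j ⟩ ≡ true
  filled i j a b = rowContiguous i (first i) j (last i)
                     (subst (_≤ toℕ j) (sym (FP.toℕ-fromℕ< (lo<n i))) a)
                     (subst (toℕ j ≤_) (sym (FP.toℕ-fromℕ< (hi<n i))) b) (first-true i) (last-true i)

  first-leftmost : ∀ i → Leftmost P i (first i)
  first-leftmost i = first-true i , λ j j<a →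
    ¬-not (λ e → <⇒≱ (subst (toℕ j <_) (FP.toℕ-fromℕ< (lo<n i)) j<a) (proj₁ (bounded i j e)))

  last-rightmost : ∀ i → Rightmost P i (last i)
  last-rightmost i = last-true i , λ j b<j →
    ¬-not (λ e → <⇒≱ (subst (_< toℕ j) (FP.toℕ-fromℕ< (hi<n i)) b<j) (proj₂ (bounded i j e)))

  lo≤hi-fin : ∀ i → lo (toℕ i) ≤ hi (toℕ i)
  lo≤hi-fin i = let b = bounded i _ (first-true i) in ≤-trans (proj₁ b) (proj₂ b)

  lo-suc≤hi : ∀ i → suc i < suc k → lo (suc i) ≤ hi i
  lo-suc≤hi i si<m =
    subst₂ _≤_ (trans (FP.toℕ-fromℕ< (lo<n i')) (cong lo (FP.toℕ-fromℕ< si<m)))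
                 (trans (FP.toℕ-fromℕ< (hi<n i₀)) (cong hi (FP.toℕ-fromℕ< i<m)))
      (proj₁ (proj₂ (consecutiveRows i₀ i' i'≡ (first i₀) (last i₀) (first i') (last i')
                       (first-leftmost i₀) (last-rightmost i₀) (first-leftmost i') (last-rightmost i'))))
    where
    i<m : i < suc k
    i<m = <-trans (n<1+n i) si<m
    i₀ i' : Fin (suc k)
    i₀ = fromℕ< i<m
    i' = fromℕ< si<m
    i'≡ : suc (toℕ i₀) ≡ toℕ i'
    i'≡ = trans (cong suc (FP.toℕ-fromℕ< i<m)) (sym (FP.toℕ-fromℕ< si<m))

  row-count : ∀ (i : Fin (suc k)) → countB true (lookup P i) + lo (toℕ i) ≡ suc (hi (toℕ i))
  row-count i = countB-interval (lookup P i) (lo (toℕ i)) (hi (toℕ i)) (bounded i) (filled i) (lo≤hi-fin i) (hi<n i)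

  lo-first : lo 0 ≡ 0
  lo-first = n≤0⇒n≡0 (proj₁ (bounded F.zero F.zero (firstCell F.zero F.zero refl refl)))

  hi-last : hi k ≡ l
  hi-last = ≤-antisym (≤-pred (subst (_< suc l) (cong hi (FP.toℕ-fromℕ k)) (hi<n (F.fromℕ k))))
    (subst₂ _≤_ (FP.toℕ-fromℕ l) (cong hi (FP.toℕ-fromℕ k))
      (proj₂ (bounded (F.fromℕ k) (F.fromℕ l)
        (lastCell (F.fromℕ k) (F.fromℕ l) (cong suc (FP.toℕ-fromℕ k)) (cong suc (FP.toℕ-fromℕ l))))))

  -- The ribbon has exactly m + n - 1 ones, so every overlap of consecutive rows is a single cell.
  no-overlap : sumBelow (λ i → hi i ∸ lo (suc i)) k ≡ 0
  no-overlap = +-cancelˡ-≡ (suc l + k) _ 0 (begin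
      suc l + k + sumBelow (λ i → hi i ∸ lo (suc i)) k
    ≡⟨ cong (λ w → suc w + k + sumBelow (λ i → hi i ∸ lo (suc i)) k) (sym hi-last) ⟩
      suc (hi k) + k + sumBelow (λ i → hi i ∸ lo (suc i)) k
    ≡⟨ sym (ones-rows P lo hi row-count (λ i i<k → lo-suc≤hi i (s≤s i<k))) ⟩
      ones P + lo 0
    ≡⟨ cong₂ _+_ (proj₂ ribbon) lo-first ⟩
      k + suc l + 0
    ≡⟨ trans (+-identityʳ _) (trans (+-suc k l) (cong suc (+-comm k l))) ⟩
      suc l + k
    ≡⟨ sym (+-identityʳ _) ⟩
      suc l + k + 0
    ∎)
    where open ≡-Reasoning

  lo-suc : ∀ i → suc i < suc k → lo (suc i) ≡ hi i
  lo-suc i si<m = ≤-antisym (lo-suc≤hi i si<m)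
    (m∸n≡0⇒m≤n (sumBelow≡0 (λ i → hi i ∸ lo (suc i)) k no-overlap i (≤-pred si<m)))

  rows : IntervalRows P lo hi
  rows = record
    { bounded = bounded
    ; filled = filled
    ; lo-first = lo-first
    ; hi-last = λ i e → trans (cong hi (suc-injective e)) hi-last
    ; lo≤hi = λ i i<m → subst (λ w → lo w ≤ hi w) (FP.toℕ-fromℕ< i<m) (lo≤hi-fin (fromℕ< i<m))
    ; hi<n = λ i i<m → subst (λ w → hi w < suc l) (FP.toℕ-fromℕ< i<m) (hi<n (fromℕ< i<m))
    ; lo-suc = lo-suc
    }

  column-covered : ∀ i → i < suc k → ∀ j → j ≤ hi i → ∃[ i' ] (i' ≤ i × lo i' ≤ j × j ≤ hi i')
  column-covered zero _ j j≤hi = 0 , z≤n , subst (_≤ j) (sym lo-first) z≤n , j≤hi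
  column-covered (suc i) si<m j j≤hi with j ≤? hi i
  ... | yes j≤hi' with column-covered i (<-trans (n<1+n i) si<m) j j≤hi'
  ...   | i' , i'≤i , a , b = i' , m≤n⇒m≤1+n i'≤i , a , b
  column-covered (suc i) si<m j j≤hi | no j≰hi' =
    suc i , ≤-refl , subst (_≤ j) (sym (lo-suc i si<m)) (<⇒≤ (≰⇒> j≰hi')) , j≤hi

  column : Fin (suc l) → Vec Bool (suc k)
  column j = V.map (λ r → lookup r j) P

  topmost : ∀ (j : Fin (suc l)) → ∃[ t ] (Topmost P j t)
  topmost j with column-covered k ≤-refl (toℕ j) (subst (toℕ j ≤_) (sym hi-last) (≤-pred (FP.toℕ<n j)))
  ... | i , i≤k , a , b = fromℕ< t<m , top , above
    where
    i<m : i < suc k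
    i<m = s≤s i≤k
    i-true : lookup (column j) (fromℕ< i<m) ≡ true
    i-true = trans (VP.lookup-map (fromℕ< i<m) _ P)
      (filled _ j (subst (λ w → lo w ≤ toℕ j) (sym (FP.toℕ-fromℕ< i<m)) a)
                  (subst (λ w → toℕ j ≤ hi w) (sym (FP.toℕ-fromℕ< i<m)) b))
    t<m : firstTrue (column j) < suc k
    t<m = ≤-<-trans (firstTrue≤ (column j) _ i-true) (FP.toℕ<n (fromℕ< i<m))
    top : P ⟨ fromℕ< t<m , j ⟩ ≡ true
    top = trans (sym (VP.lookup-map (fromℕ< t<m) _ P)) (firstTrue-true (column j) t<m)
    above : ∀ r → r F.< fromℕ< t<m → P ⟨ r , j ⟩ ≡ false
    above r r<t = ¬-not (λ e → <⇒≱ (subst (toℕ r <_) (FP.toℕ-fromℕ< t<m) r<t)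
                                   (firstTrue≤ (column j) r (trans (VP.lookup-map r _ P) e)))

-- φ on EW-tableaux
module Forward {k l : ℕ} (T : Tableau (suc k) (suc l)) (ew : IsEW T) where
  open IsEW ew

  m n : ℕ
  m = suc k
  n = suc l

  column : Fin n → Vec Bool m
  column b = V.map (λ r → lookup r b) T

  column-lookup : ∀ a b → lookup (column b) a ≡ T ⟨ a , b ⟩
  column-lookup a b = VP.lookup-map a (λ r → lookup r b) T

  labelledColumn : Fin n → ℕ × Vec Bool m
  labelledColumn j = m + toℕ j , column j

  zerosKey : ℕ × Vec Bool m → ℕ
  zerosKey c = countB false (proj₂ c)

  sortedCols : Vec (ℕ × Vec Bool m) n
  sortedCols = sortDesc zerosKey (tabulate labelledColumn)

  T₁ : Tableau m n
  T₁ = tabulate (λ i → V.map (λ c → lookup (proj₂ c) i) sortedCols)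

  colLabels : Vec ℕ n
  colLabels = V.map proj₁ sortedCols

  labelledRow : Fin m → ℕ × Vec Bool n
  labelledRow i = toℕ i , lookup T₁ i

  onesKey : ℕ × Vec Bool n → ℕ
  onesKey r = countB true (proj₂ r)

  sortedRows : Vec (ℕ × Vec Bool n) m
  sortedRows = sortDesc onesKey (tabulate labelledRow)

  X : Tableau m n
  X = V.map proj₂ sortedRows

  rowLabels : Vec ℕ m
  rowLabels = V.map proj₁ sortedRows

  R : Tableau m n
  R = step3 X

  φ-≡ : φ T ≡ (R , rowLabels , colLabels)
  φ-≡ = refl

  module ColSort = StableSort zerosKey proj₁
  module RowSort = StableSort onesKey proj₁

  sortedCols-↭ : toList sortedCols ↭ toList (tabulate labelledColumn)
  sortedCols-↭ = ColSort.sortDesc-↭ (tabulate labelledColumn)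

  sortedCols-from : ∀ j → ∃[ b ] (lookup sortedCols j ≡ labelledColumn b)
  sortedCols-from j with ∈toList⇒lookup _ (∈-resp-↭ sortedCols-↭ (lookup∈toList sortedCols j))
  ... | b , e = b , trans (sym e) (VP.lookup∘tabulate labelledColumn b)

  sortedCols-contains : ∀ b → ∃[ j ] (lookup sortedCols j ≡ labelledColumn b)
  sortedCols-contains b with ∈toList⇒lookup sortedCols (∈-resp-↭ (↭-sym sortedCols-↭) (lookup∈toList _ b))
  ... | j , e = j , trans e (VP.lookup∘tabulate labelledColumn b)

  sortedCols-sorted : AllPairs ColSort._≺_ (toList sortedCols)
  sortedCols-sorted = ColSort.sortDesc-sorted (tabulate labelledColumn)
                        (AllPairs-tabulate labelledColumn (λ _ _ → +-monoʳ-< m))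

  sortedCols-≺ : ∀ j j' → toℕ j < toℕ j' → lookup sortedCols j ColSort.≺ lookup sortedCols j'
  sortedCols-≺ = AllPairs-lookup sortedCols sortedCols-sorted

  T₁-⟨⟩ : ∀ a j → T₁ ⟨ a , j ⟩ ≡ lookup (proj₂ (lookup sortedCols j)) a
  T₁-⟨⟩ a j = trans (cong (λ r → lookup r j) (VP.lookup∘tabulate row a))
                    (VP.lookup-map j (λ c → lookup (proj₂ c) a) sortedCols)
    where
    row : Fin m → Vec Bool n
    row i = V.map (λ c → lookup (proj₂ c) i) sortedCols

  colLabels-lookup : ∀ j → lookup colLabels j ≡ proj₁ (lookup sortedCols j)
  colLabels-lookup j = VP.lookup-map j proj₁ sortedCols

  T₁-from-T : ∀ a j b → lookup sortedCols j ≡ labelledColumn b → T₁ ⟨ a , j ⟩ ≡ T ⟨ a , b ⟩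
  T₁-from-T a j b e = trans (T₁-⟨⟩ a j) (trans (cong (λ c → lookup (proj₂ c) a) e) (column-lookup a b))

  sortedRows-↭ : toList sortedRows ↭ toList (tabulate labelledRow)
  sortedRows-↭ = RowSort.sortDesc-↭ (tabulate labelledRow)

  sortedRows-from : ∀ i → ∃[ a ] (lookup sortedRows i ≡ labelledRow a)
  sortedRows-from i with ∈toList⇒lookup _ (∈-resp-↭ sortedRows-↭ (lookup∈toList sortedRows i))
  ... | a , e = a , trans (sym e) (VP.lookup∘tabulate labelledRow a)

  sortedRows-contains : ∀ a → ∃[ i ] (lookup sortedRows i ≡ labelledRow a)
  sortedRows-contains a with ∈toList⇒lookup sortedRows (∈-resp-↭ (↭-sym sortedRows-↭) (lookup∈toList _ a))
  ... | i , e = i , trans e (VP.lookup∘tabulate labelledRow a)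

  sortedRows-sorted : AllPairs RowSort._≺_ (toList sortedRows)
  sortedRows-sorted = RowSort.sortDesc-sorted (tabulate labelledRow) (AllPairs-tabulate labelledRow (λ _ _ p<q → p<q))

  sortedRows-≺ : ∀ i i' → toℕ i < toℕ i' → lookup sortedRows i RowSort.≺ lookup sortedRows i'
  sortedRows-≺ = AllPairs-lookup sortedRows sortedRows-sorted

  X-row : ∀ i → lookup X i ≡ proj₂ (lookup sortedRows i)
  X-row i = VP.lookup-map i proj₂ sortedRows

  rowLabels-lookup : ∀ i → lookup rowLabels i ≡ proj₁ (lookup sortedRows i)
  rowLabels-lookup i = VP.lookup-map i proj₁ sortedRows

  X-from-T₁ : ∀ i j a → lookup sortedRows i ≡ labelledRow a → X ⟨ i , j ⟩ ≡ T₁ ⟨ a , j ⟩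
  X-from-T₁ i j a e = trans (cong (λ r → lookup r j) (X-row i)) (cong (λ c → lookup (proj₂ c) j) e)

  -- the forbidden 2 × 2 pattern says exactly that zero sets of columns are nested
  columns-nested : ∀ b b' → Nested false (column b') (column b)
  columns-nested b b' p q b'p bp b'q bq = noPattern p q b' b p≢q b'≢b
      (trans (sym (column-lookup p b')) b'p , trans (sym (column-lookup q b)) bq ,
       trans (sym (column-lookup p b)) (¬-not bp) , trans (sym (column-lookup q b')) (¬-not b'q))
    where
    p≢q : p ≢ q
    p≢q refl = b'q b'p
    b'≢b : b' ≢ b
    b'≢b refl = bp b'p

  T₁-row-monotone : ∀ a → Monotone (lookup T₁ a)
  T₁-row-monotone a j j' j≤j' e with m≤n⇒m<n∨m≡n j≤j'
  ... | inj₂ j≡j' = subst (λ w → T₁ ⟨ a , w ⟩ ≡ true) (FP.toℕ-injective j≡j') e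
  ... | inj₁ j<j' with sortedCols-from j | sortedCols-from j'
  ...   | b , eb | b' , eb' = ¬-not λ f → ≡true⇒≢false (trans (sym (T₁-from-T a j b eb)) e)
          (trans (sym (column-lookup a b)) (nested-countB≤⇒⊆ false (column b') (column b) (columns-nested b b')
            zeros≤ a (trans (column-lookup a b') (trans (sym (T₁-from-T a j' b' eb')) f))))
    where
    zeros≤ : countB false (column b') ≤ countB false (column b)
    zeros≤ = subst₂ _≤_ (cong zerosKey eb') (cong zerosKey eb)
               (ColSort.≺⇒key≥ {lookup sortedCols j} {lookup sortedCols j'} (sortedCols-≺ j j' j<j'))

  T₁-rows-nested : ∀ a a' → Nested true (lookup T₁ a) (lookup T₁ a')
  T₁-rows-nested a a' p q ap a'p aq a'q with toℕ p ≤? toℕ q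
  ... | yes p≤q = aq (T₁-row-monotone a p q p≤q ap)
  ... | no p≰q = a'p (T₁-row-monotone a' q p (<⇒≤ (≰⇒> p≰q)) a'q)

  X-column-monotone : ∀ (i i' : Fin m) j → toℕ i' ≤ toℕ i → X ⟨ i , j ⟩ ≡ true → X ⟨ i' , j ⟩ ≡ true
  X-column-monotone i i' j i'≤i e with m≤n⇒m<n∨m≡n i'≤i
  ... | inj₂ i'≡i = subst (λ w → X ⟨ w , j ⟩ ≡ true) (sym (FP.toℕ-injective i'≡i)) e
  ... | inj₁ i'<i with sortedRows-from i | sortedRows-from i'
  ...   | a , ea | a' , ea' = trans (X-from-T₁ i' j a' ea')
          (nested-countB≤⇒⊆ true (lookup T₁ a) (lookup T₁ a') (T₁-rows-nested a a') ones≤ j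
            (trans (sym (X-from-T₁ i j a ea)) e))
    where
    ones≤ : countB true (lookup T₁ a) ≤ countB true (lookup T₁ a')
    ones≤ = subst₂ _≤_ (cong onesKey ea) (cong onesKey ea')
              (RowSort.≺⇒key≥ {lookup sortedRows i'} {lookup sortedRows i} (sortedRows-≺ i' i i'<i))

  X-row-monotone : ∀ i → Monotone (lookup X i)
  X-row-monotone i j j' j≤j' e with sortedRows-from i
  ... | a , ea = trans (X-from-T₁ i j' a ea) (T₁-row-monotone a j j' j≤j' (trans (sym (X-from-T₁ i j a ea)) e))

  T₁-top : ∀ j → T₁ ⟨ F.zero , j ⟩ ≡ true
  T₁-top j with sortedCols-from j
  ... | b , eb = trans (T₁-from-T F.zero j b eb) (topRow F.zero b refl)

  -- the full top row has the largest number of ones and the smallest label, so it stays first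
  sortedRows-first : lookup sortedRows F.zero ≡ labelledRow F.zero
  sortedRows-first with sortedRows-contains F.zero
  ... | F.zero , e = e
  ... | F.suc q , e with sortedRows-≺ F.zero (F.suc q) (s≤s z≤n)
  ...   | inj₁ lt = ⊥-elim (<⇒≱ lt (subst (onesKey (lookup sortedRows F.zero) ≤_) (sym full)
                                          (countB≤length true (proj₂ (lookup sortedRows F.zero)))))
    where
    full : onesKey (lookup sortedRows (F.suc q)) ≡ n
    full = trans (cong onesKey e) (countB-all true (lookup T₁ F.zero) T₁-top)
  ...   | inj₂ (_ , lt) = ⊥-elim (<⇒≱ (subst (proj₁ (lookup sortedRows F.zero) <_) (cong proj₁ e) lt) z≤n)

  sortedRows-later : ∀ i a → lookup sortedRows i ≡ labelledRow a → toℕ i ≢ 0 → toℕ a ≢ 0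
  sortedRows-later F.zero a e i≢0 _ = i≢0 refl
  sortedRows-later (F.suc i) a e _ a≡0 with FP.toℕ-injective {i = a} {j = F.zero} a≡0
  ... | refl = RowSort.≺-irrefl {lookup sortedRows F.zero}
                 (subst (lookup sortedRows F.zero RowSort.≺_) (trans e (sym sortedRows-first))
                                   (sortedRows-≺ F.zero (F.suc i) (s≤s z≤n)))

  X-top : ∀ j → X ⟨ F.zero , j ⟩ ≡ true
  X-top j = trans (X-from-T₁ F.zero j F.zero sortedRows-first) (T₁-top j)

  X-other : ∀ i → toℕ i ≢ 0 → X ⟨ i , F.zero ⟩ ≡ false
  X-other i i≢0 with sortedRows-from i
  ... | a , ea with otherRow a (sortedRows-later i a ea i≢0)
  ...   | b , Tab≡0 with sortedCols-contains b
  ...     | j , eb = ¬-not λ e → ≡true⇒≢false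
              (T₁-row-monotone a F.zero j z≤n (trans (sym (X-from-T₁ i F.zero a ea)) e))
              (trans (T₁-from-T a j b eb) Tab≡0)

  zeros : ℕ → ℕ
  zeros i = maybe (countB false) n (getV X i)

  zeros-toℕ : ∀ i → zeros (toℕ i) ≡ countB false (lookup X i)
  zeros-toℕ i rewrite getV-toℕ X i = refl

  zeros≤⇒true : ∀ i j → zeros (toℕ i) ≤ toℕ j → X ⟨ i , j ⟩ ≡ true
  zeros≤⇒true i j h = proj₂ (monotone-true⇔ (lookup X i) (X-row-monotone i) j) (subst (_≤ toℕ j) (zeros-toℕ i) h)

  true⇒zeros≤ : ∀ i j → X ⟨ i , j ⟩ ≡ true → zeros (toℕ i) ≤ toℕ j
  true⇒zeros≤ i j e =
    subst (_≤ toℕ j) (sym (zeros-toℕ i)) (proj₁ (monotone-true⇔ (lookup X i) (X-row-monotone i) j) e)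

  zeros-first : zeros 0 ≡ 0
  zeros-first = trans (zeros-toℕ F.zero) (countB-none false (lookup X F.zero) (≡true⇒≢false ∘ X-top))

  zeros-beyond : ∀ i → m ≤ i → zeros i ≡ n
  zeros-beyond i h rewrite getV-≥ X i h = refl

  zeros≤n : ∀ i → zeros i ≤ n
  zeros≤n i with getV X i
  ... | nothing = ≤-refl
  ... | just r = countB≤length false r

  zeros-pos : ∀ i → 1 ≤ i → 1 ≤ zeros i
  zeros-pos i 1≤i with i <? m
  ... | no i≮m = subst (1 ≤_) (sym (zeros-beyond i (≮⇒≥ i≮m))) (s≤s z≤n)
  ... | yes i<m = subst (1 ≤_) (cong zeros (FP.toℕ-fromℕ< i<m)) (≰⇒> zeros≰0)
    where
    zeros≰0 : ¬ zeros (toℕ (fromℕ< i<m)) ≤ 0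
    zeros≰0 le = ≡true⇒≢false (zeros≤⇒true (fromℕ< i<m) F.zero le)
      (X-other (fromℕ< i<m) (λ e → <⇒≢ 1≤i (sym (trans (sym (FP.toℕ-fromℕ< i<m)) e))))

  zeros-pos-fin : ∀ (i : Fin m) → toℕ i ≢ 0 → 1 ≤ zeros (toℕ i)
  zeros-pos-fin i i≢0 = zeros-pos (toℕ i) (≰⇒> (i≢0 ∘ n≤0⇒n≡0))

  zeros-step : ∀ i → suc i < m → zeros i ≤ zeros (suc i)
  zeros-step i si<m with zeros (suc i) <? n
  ... | no z≮n = ≤-trans (zeros≤n i) (≮⇒≥ z≮n)
  ... | yes z<n = subst₂ _≤_ (cong zeros (FP.toℕ-fromℕ< i<m)) (FP.toℕ-fromℕ< z<n)
          (true⇒zeros≤ (fromℕ< i<m) (fromℕ< z<n)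
            (X-column-monotone (fromℕ< si<m) (fromℕ< i<m) (fromℕ< z<n)
              (subst₂ _≤_ (sym (FP.toℕ-fromℕ< i<m)) (sym (FP.toℕ-fromℕ< si<m)) (n≤1+n i))
              (zeros≤⇒true (fromℕ< si<m) (fromℕ< z<n)
                (subst₂ _≤_ (cong zeros (sym (FP.toℕ-fromℕ< si<m))) (sym (FP.toℕ-fromℕ< z<n)) ≤-refl))))
    where
    i<m : i < m
    i<m = <-trans (n<1+n i) si<m

  lo : ℕ → ℕ
  lo i = zeros i ∸ 1

  hi : ℕ → ℕ
  hi i = zeros (suc i) ∸ 1

  boundary : IntervalRows R lo hi
  boundary = Staircase.boundary X zeros true⇒zeros≤ zeros≤⇒true zeros-first zeros-pos zeros-step
               zeros-beyond zeros≤n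

  open IntervalRowsProperties boundary

  rowLabels-↭ : toList rowLabels ↭ L.upTo m
  rowLabels-↭ = ↭-trans (↭.↭-reflexive (VP.toList-map proj₁ sortedRows))
                  (↭-trans (map⁺ proj₁ sortedRows-↭)
                    (↭.↭-reflexive (trans (map-toList-tabulate proj₁ labelledRow) (toList-tabulate-toℕ id))))

  colLabels-↭ : toList colLabels ↭ L.map (m +_) (L.upTo n)
  colLabels-↭ = ↭-trans (↭.↭-reflexive (VP.toList-map proj₁ sortedCols))
                  (↭-trans (map⁺ proj₁ sortedCols-↭)
                    (↭.↭-reflexive (trans (map-toList-tabulate proj₁ labelledColumn)
                      (trans (toList-tabulate-toℕ (m +_)) (sym (LP.map-upTo (m +_) n))))))

  rowLabels-first : ∀ i → toℕ i ≡ 0 → lookup rowLabels i ≡ 0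
  rowLabels-first i i≡0 with FP.toℕ-injective {i = i} {j = F.zero} i≡0
  ... | refl = trans (rowLabels-lookup F.zero) (cong proj₁ sortedRows-first)

  ∸1-injective : ∀ a b → 1 ≤ a → 1 ≤ b → a ∸ 1 ≡ b ∸ 1 → a ≡ b
  ∸1-injective (suc a) (suc b) _ _ e = cong suc e

  -- rows of R starting in the same column come from identical rows of X, i.e. from a tie in the row sort
  rowLabels-increasing : ∀ (i i' : Fin m) (j : Fin n) → i F.< i' → Leftmost R i j → Leftmost R i' j →
    lookup rowLabels i < lookup rowLabels i'
  rowLabels-increasing i i' j i<i' li li' with toℕ i ≟ 0
  ... | yes i≡0 with sortedRows-from i'
  ...   | a , ea = subst₂ _<_ (sym (rowLabels-first i i≡0)) (sym (trans (rowLabels-lookup i') (cong proj₁ ea)))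
                     (≰⇒> (λ le → sortedRows-later i' a ea (λ e → <⇒≢ (subst (_< toℕ i') i≡0 i<i') (sym e))
                                    (n≤0⇒n≡0 le)))
  rowLabels-increasing i i' j i<i' li li' | no i≢0 with sortedRows-≺ i i' i<i'
  ... | inj₁ lt = ⊥-elim (<-irrefl (sym ones≡) lt)
    where
    zeros≡ : zeros (toℕ i) ≡ zeros (toℕ i')
    zeros≡ = ∸1-injective _ _ (zeros-pos-fin i i≢0)
               (zeros-pos-fin i' (λ e → <⇒≱ i<i' (subst (_≤ toℕ i) (sym e) z≤n)))
               (trans (sym (leftmost-toℕ i j li)) (leftmost-toℕ i' j li'))
    row≡ : lookup X i ≡ lookup X i'
    row≡ = vec-ext λ j' → ≡true-ext
      (λ e → zeros≤⇒true i' j' (subst (_≤ toℕ j') zeros≡ (true⇒zeros≤ i j' e)))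
      (λ e → zeros≤⇒true i j' (subst (_≤ toℕ j') (sym zeros≡) (true⇒zeros≤ i' j' e)))
    ones≡ : onesKey (lookup sortedRows i) ≡ onesKey (lookup sortedRows i')
    ones≡ = cong (countB true) (trans (sym (X-row i)) (trans row≡ (X-row i')))
  ... | inj₂ (_ , lt) = subst₂ _<_ (sym (rowLabels-lookup i)) (sym (rowLabels-lookup i')) lt

  X-column-by-topmost : ∀ j t → Topmost R j t → ∀ i → X ⟨ i , j ⟩ ≡ (toℕ i ≤ᵇ toℕ t)
  X-column-by-topmost j t top i = ≡true-ext to from
    where
    to : X ⟨ i , j ⟩ ≡ true → (toℕ i ≤ᵇ toℕ t) ≡ true
    to e = ≤⇒≤ᵇ≡true (≮⇒≥ λ t<i → <⇒≱
             (≤-<-trans (topmost-column≤lo j t top (toℕ i) t<i (FP.toℕ<n i))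
                        (n∸1<n (zeros (toℕ i)) (zeros-pos (toℕ i) (≤-trans (s≤s z≤n) t<i))))
             (true⇒zeros≤ i j e))
    from : (toℕ i ≤ᵇ toℕ t) ≡ true → X ⟨ i , j ⟩ ≡ true
    from e with toℕ i ≟ 0
    ... | yes i≡0 with FP.toℕ-injective {i = i} {j = F.zero} i≡0
    ...   | refl = X-top j
    from e | no i≢0 =
      zeros≤⇒true i j (lo<⇒zeros≤ (lo<topmost-column j t top (toℕ i) (≰⇒> (i≢0 ∘ n≤0⇒n≡0)) (≤ᵇ≡true⇒≤ e)))
      where
      lo<⇒zeros≤ : lo (toℕ i) < toℕ j → zeros (toℕ i) ≤ toℕ j
      lo<⇒zeros≤ lt with zeros (toℕ i) | zeros-pos-fin i i≢0
      ... | suc z | _ = lt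

  -- columns of R with topmost 1 in the same row come from identical columns of T
  colLabels-increasing : ∀ (j j' : Fin n) (t : Fin m) → j F.< j' → Topmost R j t → Topmost R j' t →
    lookup colLabels j < lookup colLabels j'
  colLabels-increasing j j' t j<j' tj tj' with sortedCols-≺ j j' j<j'
  ... | inj₁ lt = ⊥-elim (<-irrefl (sym zeros≡) lt)
    where
    column≡ : ∀ a → lookup (proj₂ (lookup sortedCols j)) a ≡ lookup (proj₂ (lookup sortedCols j')) a
    column≡ a with sortedRows-contains a
    ... | i , ei = trans (sym (T₁-⟨⟩ a j)) (trans (sym (X-from-T₁ i j a ei))
                     (trans (trans (X-column-by-topmost j t tj i) (sym (X-column-by-topmost j' t tj' i)))
                       (trans (X-from-T₁ i j' a ei) (T₁-⟨⟩ a j'))))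
    zeros≡ : zerosKey (lookup sortedCols j) ≡ zerosKey (lookup sortedCols j')
    zeros≡ = cong (countB false) (vec-ext {u = proj₂ (lookup sortedCols j)} {v = proj₂ (lookup sortedCols j')} column≡)
  ... | inj₂ (_ , lt) = subst₂ _<_ (sym (colLabels-lookup j)) (sym (colLabels-lookup j')) lt

  φ-LRib : IsLRib (φ T)
  φ-LRib = record
    { ribbon = intervalRows⇒ribbon boundary
    ; rowPerm = rowLabels-↭
    ; rowFirst = rowLabels-first
    ; rowIncr = rowLabels-increasing
    ; colPerm = colLabels-↭
    ; colIncr = colLabels-increasing
    }

  zeros-by-leftmost : ∀ i c → toℕ i ≢ 0 → Leftmost R i c → zeros (toℕ i) ≡ suc (toℕ c)
  zeros-by-leftmost i c i≢0 lc with zeros (toℕ i) | zeros-pos-fin i i≢0 | leftmost-toℕ i c lc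
  ... | suc z | _ | c≡z = cong suc (sym c≡z)

  entry-by-labels : ∀ a b i j → lookup sortedRows i ≡ labelledRow a → lookup sortedCols j ≡ labelledColumn b →
    T ⟨ a , b ⟩ ≡ X ⟨ i , j ⟩
  entry-by-labels a b i j ei ej = sym (trans (X-from-T₁ i j a ei) (T₁-from-T a j b ej))

φ-injective : ∀ {k l} (T U : Tableau (suc k) (suc l)) → IsEW T → IsEW U → φ T ≡ φ U → T ≡ U
φ-injective {k} {l} T U ewT ewU φ≡ = vec-ext λ a → vec-ext λ b → entry≡ a b
  where
  module FT = Forward T ewT
  module FU = Forward U ewU
  module RT = IntervalRowsProperties FT.boundary

  zeros≡ : ∀ (i : Fin (suc k)) → FT.zeros (toℕ i) ≡ FU.zeros (toℕ i)
  zeros≡ i with toℕ i ≟ 0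
  ... | yes i≡0 rewrite i≡0 = trans FT.zeros-first (sym FU.zeros-first)
  ... | no i≢0 = trans (FT.zeros-by-leftmost i c i≢0 (RT.leftmost i))
                       (sym (FU.zeros-by-leftmost i c i≢0
                              (subst (λ Q → Leftmost Q i c) (cong proj₁ φ≡) (RT.leftmost i))))
    where
    c = fromℕ< (RT.lo<n (toℕ i) (FP.toℕ<n i))

  X≡ : ∀ i j → FT.X ⟨ i , j ⟩ ≡ FU.X ⟨ i , j ⟩
  X≡ i j = ≡true-ext (λ e → FU.zeros≤⇒true i j (subst (_≤ toℕ j) (zeros≡ i) (FT.true⇒zeros≤ i j e)))
                     (λ e → FT.zeros≤⇒true i j (subst (_≤ toℕ j) (sym (zeros≡ i)) (FU.true⇒zeros≤ i j e)))

  entry≡ : ∀ a b → T ⟨ a , b ⟩ ≡ U ⟨ a , b ⟩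
  entry≡ a b with FT.sortedCols-contains b | FT.sortedRows-contains a
  ... | j , ej | i , ei with FU.sortedCols-from j | FU.sortedRows-from i
  ...   | b' , ej' | a' , ei' =
    trans (FT.entry-by-labels a b i j ei ej)
      (trans (X≡ i j) (sym (subst₂ (λ x y → U ⟨ x , y ⟩ ≡ FU.X ⟨ i , j ⟩) a'≡a b'≡b
                              (FU.entry-by-labels a' b' i j ei' ej'))))
    where
    b'≡b : b' ≡ b
    b'≡b = FP.toℕ-injective (+-cancelˡ-≡ (suc k) _ _
      (trans (sym (cong proj₁ ej')) (trans (sym (FU.colLabels-lookup j))
        (trans (cong (λ L → lookup (proj₂ (proj₂ L)) j) (sym φ≡)) (trans (FT.colLabels-lookup j) (cong proj₁ ej))))))
    a'≡a : a' ≡ a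
    a'≡a = FP.toℕ-injective
      (trans (sym (cong proj₁ ei')) (trans (sym (FU.rowLabels-lookup i))
        (trans (cong (λ L → lookup (proj₁ (proj₂ L)) i) (sym φ≡)) (trans (FT.rowLabels-lookup i) (cong proj₁ ei)))))

-- The inverse of φ
indexOf : ∀ {k} → Vec ℕ k → ℕ → ℕ
indexOf [] a = 0
indexOf (x ∷ v) a with x ≟ a
... | yes _ = 0
... | no _ = suc (indexOf v a)

indexOf-found : ∀ {k} (v : Vec ℕ k) a → a ∈ toList v → ∃[ p ] (indexOf v a ≡ toℕ p × lookup v p ≡ a)
indexOf-found (x ∷ v) a a∈ with x ≟ a
... | yes x≡a = F.zero , refl , x≡a
... | no x≢a with a∈
...   | here a≡x = ⊥-elim (x≢a (sym a≡x))
...   | there a∈v with indexOf-found v a a∈v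
...     | p , e₁ , e₂ = F.suc p , cong suc e₁ , e₂

indexOf-lookup : ∀ {k} (v : Vec ℕ k) → Unique (toList v) → ∀ i → indexOf v (lookup v i) ≡ toℕ i
indexOf-lookup (x ∷ v) _ F.zero with x ≟ x
... | yes _ = refl
... | no x≢x = ⊥-elim (x≢x refl)
indexOf-lookup (x ∷ v) (x∉v AllPairs.∷ u) (F.suc i) with x ≟ lookup v i
... | yes x≡ = ⊥-elim (All.lookup x∉v (lookup∈toList v i) x≡)
... | no _ = cong suc (indexOf-lookup v u i)

threshold-noPattern : ∀ {m n} (T : Tableau m n) (f : Fin m → ℕ) (g : Fin n → ℕ) →
  (∀ a b → T ⟨ a , b ⟩ ≡ (f a ≤ᵇ g b)) → ∀ i i' k k' →
  ¬ (T ⟨ i , k ⟩ ≡ false × T ⟨ i' , k' ⟩ ≡ false × T ⟨ i , k' ⟩ ≡ true × T ⟨ i' , k ⟩ ≡ true)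
threshold-noPattern T f g T≡ i i' k k' (ik , i'k' , ik' , i'k) =
  <-asym (<-≤-trans (g< i k ik) (≤g i k' ik')) (<-≤-trans (g< i' k' i'k') (≤g i' k i'k))
  where
  g< : ∀ a b → T ⟨ a , b ⟩ ≡ false → g b < f a
  g< a b e = ≰⇒> λ le → ≡true⇒≢false (trans (T≡ a b) (≤⇒≤ᵇ≡true le)) e
  ≤g : ∀ a b → T ⟨ a , b ⟩ ≡ true → f a ≤ g b
  ≤g a b e = ≤ᵇ≡true⇒≤ (trans (sym (T≡ a b)) e)

intervalRows-≡ : ∀ {m n} {P Q : Tableau m n} {lo hi lo' hi'} → IntervalRows P lo hi → IntervalRows Q lo' hi' →
  (∀ (i : Fin m) → lo (toℕ i) ≡ lo' (toℕ i)) → (∀ (i : Fin m) → hi (toℕ i) ≡ hi' (toℕ i)) → P ≡ Q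
intervalRows-≡ {P = P} {Q} P-rows Q-rows lo≡ hi≡ =
  vec-ext λ i → vec-ext λ j → ≡true-ext (to i j) (from i j)
  where
  module RowsP = IntervalRows P-rows
  module RowsQ = IntervalRows Q-rows
  to : ∀ i j → P ⟨ i , j ⟩ ≡ true → Q ⟨ i , j ⟩ ≡ true
  to i j e = RowsQ.filled i j (subst (_≤ toℕ j) (lo≡ i) (proj₁ (RowsP.bounded i j e)))
                              (subst (toℕ j ≤_) (hi≡ i) (proj₂ (RowsP.bounded i j e)))
  from : ∀ i j → Q ⟨ i , j ⟩ ≡ true → P ⟨ i , j ⟩ ≡ true
  from i j e = RowsP.filled i j (subst (_≤ toℕ j) (sym (lo≡ i)) (proj₁ (RowsQ.bounded i j e)))
                                (subst (toℕ j ≤_) (sym (hi≡ i)) (proj₂ (RowsQ.bounded i j e)))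

module Backward {k l : ℕ} (P : Tableau (suc k) (suc l)) (rl : Vec ℕ (suc k)) (cl : Vec ℕ (suc l))
                (lrib : IsLRib (P , rl , cl)) where
  module LR = IsLRib lrib

  m n : ℕ
  m = suc k
  n = suc l

  open RibbonRows P LR.ribbon using (lo; hi; rows; topmost)
  open IntervalRowsProperties rows using (lo<n; lo-suc-mono; leftmost; lo<topmost-column; topmost-column≤lo)
  module Rows = IntervalRows rows

  -- row i ≥ 1 of the staircase becomes 1 just right of the first cell of row i of the ribbon
  z : ℕ → ℕ
  z zero = 0
  z (suc i) with suc i <? m
  ... | yes _ = suc (lo (suc i))
  ... | no _ = n

  z-suc : ∀ i → suc i < m → z (suc i) ≡ suc (lo (suc i))
  z-suc i si<m with suc i <? m
  ... | yes _ = refl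
  ... | no si≮m = ⊥-elim (si≮m si<m)

  z≡suc-lo : ∀ i → 1 ≤ i → i < m → z i ≡ suc (lo i)
  z≡suc-lo (suc i) _ si<m = z-suc i si<m

  z-beyond : ∀ i → m ≤ i → z i ≡ n
  z-beyond (suc i) m≤si with suc i <? m
  ... | yes si<m = ⊥-elim (<⇒≱ si<m m≤si)
  ... | no _ = refl

  z-pos : ∀ i → 1 ≤ i → 1 ≤ z i
  z-pos (suc i) _ with suc i <? m
  ... | yes _ = s≤s z≤n
  ... | no _ = s≤s z≤n

  z-bounded : ∀ i → z i ≤ n
  z-bounded zero = z≤n
  z-bounded (suc i) with suc i <? m
  ... | yes si<m = lo<n (suc i) si<m
  ... | no _ = ≤-refl

  z-step : ∀ i → suc i < m → z i ≤ z (suc i)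
  z-step zero _ = z≤n
  z-step (suc i) ssi<m =
    subst₂ _≤_ (sym (z-suc i (<-trans (n<1+n (suc i)) ssi<m))) (sym (z-suc (suc i) ssi<m))
      (s≤s (lo-suc-mono (suc i) ssi<m))

  z-mono : ∀ a b → a ≤ b → b < m → z a ≤ z b
  z-mono a b a≤b b<m with m≤n⇒m<n∨m≡n a≤b
  ... | inj₂ refl = ≤-refl
  ... | inj₁ a<b with b
  ...   | suc b' = ≤-trans (z-mono a b' (≤-pred a<b) (<-trans (n<1+n b') b<m)) (z-step b' b<m)

  z∸1≡lo : ∀ i → i < m → z i ∸ 1 ≡ lo i
  z∸1≡lo zero _ = sym Rows.lo-first
  z∸1≡lo (suc i) si<m = cong (_∸ 1) (z-suc i si<m)

  z-suc∸1≡hi : ∀ i → i < m → z (suc i) ∸ 1 ≡ hi i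
  z-suc∸1≡hi i i<m = by-cases (suc i <? m)
    where
    by-cases : Dec (suc i < m) → z (suc i) ∸ 1 ≡ hi i
    by-cases (yes si<m) = trans (z∸1≡lo (suc i) si<m) (Rows.lo-suc i si<m)
    by-cases (no si≮m) = trans (cong (_∸ 1) (z-beyond (suc i) (≮⇒≥ si≮m)))
                                 (sym (Rows.hi-last i (≤-antisym i<m (≮⇒≥ si≮m))))

  X : Tableau m n
  X = tabulate λ i → tabulate λ j → z (toℕ i) ≤ᵇ toℕ j

  X-⟨⟩ : ∀ i j → X ⟨ i , j ⟩ ≡ (z (toℕ i) ≤ᵇ toℕ j)
  X-⟨⟩ i j = lookup∘tabulate² (λ i j → z (toℕ i) ≤ᵇ toℕ j) i j

  entry-X : ∀ i j → i < m → j < n → entry X i j ≡ (z i ≤ᵇ j)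
  entry-X i j i<m j<n = trans (entry-fromℕ< X i j i<m j<n)
    (trans (X-⟨⟩ (fromℕ< i<m) (fromℕ< j<n)) (cong₂ (λ a b → z a ≤ᵇ b) (FP.toℕ-fromℕ< i<m) (FP.toℕ-fromℕ< j<n)))

  step3-X : step3 X ≡ P
  step3-X = intervalRows-≡ (Staircase.boundary X z true⇒z≤ z≤⇒true refl z-pos z-step z-beyond z-bounded) rows
              (λ i → z∸1≡lo (toℕ i) (FP.toℕ<n i)) (λ i → z-suc∸1≡hi (toℕ i) (FP.toℕ<n i))
    where
    true⇒z≤ : ∀ i j → X ⟨ i , j ⟩ ≡ true → z (toℕ i) ≤ toℕ j
    true⇒z≤ i j e = ≤ᵇ≡true⇒≤ (trans (sym (X-⟨⟩ i j)) e)
    z≤⇒true : ∀ i j → z (toℕ i) ≤ toℕ j → X ⟨ i , j ⟩ ≡ true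
    z≤⇒true i j h = trans (X-⟨⟩ i j) (≤⇒≤ᵇ≡true h)

  z≤⇔≤topmost : ∀ j t → Topmost P j t → ∀ i → i < m →
    (z i ≤ toℕ j → i ≤ toℕ t) × (i ≤ toℕ t → z i ≤ toℕ j)
  z≤⇔≤topmost j t top i i<m = to , from i i<m
    where
    to : z i ≤ toℕ j → i ≤ toℕ t
    to h = ≮⇒≥ λ t<i → <⇒≱ (s≤s (topmost-column≤lo j t top i t<i i<m))
                          (subst (_≤ toℕ j) (z≡suc-lo i (≤-trans (s≤s z≤n) t<i) i<m) h)
    from : ∀ i → i < m → i ≤ toℕ t → z i ≤ toℕ j
    from zero _ _ = z≤n
    from (suc i) si<m si≤t = subst (_≤ toℕ j) (sym (z-suc i si<m)) (lo<topmost-column j t top (suc i) (s≤s z≤n) si≤t)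

  rl-unique : Unique (toList rl)
  rl-unique = Unique-resp-↭ (↭-sym LR.rowPerm) (Unique.upTo⁺ m)

  cl-unique : Unique (toList cl)
  cl-unique = Unique-resp-↭ (↭-sym LR.colPerm) (Unique.map⁺ (+-cancelˡ-≡ m _ _) (Unique.upTo⁺ n))

  rl-contains : ∀ a → a < m → a ∈ toList rl
  rl-contains a a<m = ∈-resp-↭ (↭-sym LR.rowPerm) (∈-applyUpTo⁺ id a<m)

  rl< : ∀ i → lookup rl i < m
  rl< i with ∈-applyUpTo⁻ id (∈-resp-↭ LR.rowPerm (lookup∈toList rl i))
  ... | a , a<m , e = subst (_< m) (sym e) a<m

  cl-contains : ∀ b → b < n → (m + b) ∈ toList cl
  cl-contains b b<n = ∈-resp-↭ (↭-sym LR.colPerm)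
    (subst ((m + b) ∈_) (sym (LP.map-upTo (m +_) n)) (∈-applyUpTo⁺ (m +_) b<n))

  rowPos : ℕ → ℕ
  rowPos = indexOf rl

  colPos : ℕ → ℕ
  colPos = indexOf cl

  rowPos< : ∀ a → a < m → rowPos a < m
  rowPos< a a<m with indexOf-found rl a (rl-contains a a<m)
  ... | p , e , _ = subst (_< m) (sym e) (FP.toℕ<n p)

  colPos< : ∀ b → b < n → colPos (m + b) < n
  colPos< b b<n with indexOf-found cl (m + b) (cl-contains b b<n)
  ... | p , e , _ = subst (_< n) (sym e) (FP.toℕ<n p)

  rowPos-lookup : ∀ i → rowPos (lookup rl i) ≡ toℕ i
  rowPos-lookup = indexOf-lookup rl rl-unique

  colPos-lookup : ∀ j → colPos (lookup cl j) ≡ toℕ j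
  colPos-lookup = indexOf-lookup cl cl-unique

  rowPos-first : ∀ a → a < m → rowPos a ≡ 0 → a ≡ 0
  rowPos-first a a<m e with indexOf-found rl a (rl-contains a a<m)
  ... | p , e₁ , e₂ with FP.toℕ-injective {i = p} {j = F.zero} (trans (sym e₁) e)
  ...   | refl = trans (sym e₂) (LR.rowFirst F.zero refl)

  -- T places the staircase entry of the row labelled v_a and the column labelled v_{m+b} at (a , b)
  T : Tableau m n
  T = tabulate λ a → tabulate λ b → entry X (rowPos (toℕ a)) (colPos (m + toℕ b))

  T-⟨⟩ : ∀ a b → T ⟨ a , b ⟩ ≡ (z (rowPos (toℕ a)) ≤ᵇ colPos (m + toℕ b))
  T-⟨⟩ a b = trans (lookup∘tabulate² (λ a b → entry X (rowPos (toℕ a)) (colPos (m + toℕ b))) a b)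
                   (entry-X _ _ (rowPos< (toℕ a) (FP.toℕ<n a)) (colPos< (toℕ b) (FP.toℕ<n b)))

  T-EW : IsEW T
  T-EW = record { topRow = top ; otherRow = other
                ; noPattern = λ i i' k k' _ _ →
                    threshold-noPattern T (z ∘ rowPos ∘ toℕ) (colPos ∘ (m +_) ∘ toℕ) T-⟨⟩ i i' k k' }
    where
    top : ∀ i j → toℕ i ≡ 0 → T ⟨ i , j ⟩ ≡ true
    top i j i≡0 = trans (T-⟨⟩ i j) (≤⇒≤ᵇ≡true (subst (_≤ colPos (m + toℕ j)) (sym z≡0) z≤n))
      where
      z≡0 : z (rowPos (toℕ i)) ≡ 0
      z≡0 = cong z (trans (cong rowPos i≡0) (trans (cong rowPos (sym (LR.rowFirst F.zero refl))) (rowPos-lookup F.zero)))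
    other : ∀ i → toℕ i ≢ 0 → ∃[ j ] (T ⟨ i , j ⟩ ≡ false)
    other i i≢0 with ∈-applyUpTo⁻ (m +_) (subst (lookup cl F.zero ∈_) (LP.map-upTo (m +_) n)
                                              (∈-resp-↭ LR.colPerm (lookup∈toList cl F.zero)))
    ... | b , b<n , eb = fromℕ< b<n , trans (T-⟨⟩ i (fromℕ< b<n))
                           (≰⇒≤ᵇ≡false λ le → <⇒≱ (z-pos _ 1≤pos) (subst (z (rowPos (toℕ i)) ≤_) pos≡0 le))
      where
      1≤pos : 1 ≤ rowPos (toℕ i)
      1≤pos = ≰⇒> λ le → i≢0 (rowPos-first (toℕ i) (FP.toℕ<n i) (n≤0⇒n≡0 le))
      pos≡0 : colPos (m + toℕ (fromℕ< b<n)) ≡ 0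
      pos≡0 = trans (cong (λ w → colPos (m + w)) (FP.toℕ-fromℕ< b<n))
                    (trans (cong colPos (sym eb)) (colPos-lookup F.zero))

  module FT = Forward T T-EW

  -- the column of T labelled c
  stairColumn : ℕ → Vec Bool m
  stairColumn c = tabulate λ a → entry X (rowPos (toℕ a)) (colPos c)

  labelledStairColumn : ℕ → ℕ × Vec Bool m
  labelledStairColumn c = c , stairColumn c

  columnsByLabel : Vec (ℕ × Vec Bool m) n
  columnsByLabel = V.map labelledStairColumn cl

  columnsByLabel-↭ : toList columnsByLabel ↭ toList (tabulate FT.labelledColumn)
  columnsByLabel-↭ = ↭-trans (↭.↭-reflexive (VP.toList-map labelledStairColumn cl))
    (↭-trans (map⁺ labelledStairColumn LR.colPerm)
      (↭.↭-reflexive (trans (sym (LP.map-∘ (L.upTo n)))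
        (trans (LP.map-upTo (labelledStairColumn ∘ (m +_)) n)
          (trans (sym (toList-tabulate-toℕ (labelledStairColumn ∘ (m +_))))
            (cong toList (sym (VP.tabulate-cong labelledColumn≡))))))))
    where
    labelledColumn≡ : ∀ j → FT.labelledColumn j ≡ labelledStairColumn (m + toℕ j)
    labelledColumn≡ j = cong (m + toℕ j ,_) (vec-ext λ a →
      trans (VP.lookup-map a (λ r → lookup r j) T)
        (trans (lookup∘tabulate² (λ a b → entry X (rowPos (toℕ a)) (colPos (m + toℕ b))) a j)
          (sym (VP.lookup∘tabulate (λ a → entry X (rowPos (toℕ a)) (colPos (m + toℕ j))) a))))

  stairColumn-lookup : ∀ j a → lookup (stairColumn (lookup cl j)) a ≡ (z (rowPos (toℕ a)) ≤ᵇ toℕ j)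
  stairColumn-lookup j a = trans (VP.lookup∘tabulate (λ a → entry X (rowPos (toℕ a)) (colPos (lookup cl j))) a)
    (trans (cong (entry X (rowPos (toℕ a))) (colPos-lookup j)) (entry-X _ _ (rowPos< (toℕ a) (FP.toℕ<n a)) (FP.toℕ<n j)))

  columnsByLabel-lookup : ∀ j → lookup columnsByLabel j ≡ labelledStairColumn (lookup cl j)
  columnsByLabel-lookup j = VP.lookup-map j labelledStairColumn cl

  rowPos<m : ∀ (a : Fin m) → rowPos (toℕ a) < m
  rowPos<m a = rowPos< (toℕ a) (FP.toℕ<n a)

  columns-≺ : ∀ (j j' : Fin n) → toℕ j < toℕ j' → ∀ t t' → Topmost P j t → Topmost P j' t' →
    Tri (toℕ t < toℕ t') (toℕ t ≡ toℕ t') (toℕ t' < toℕ t) →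
    labelledStairColumn (lookup cl j) FT.ColSort.≺ labelledStairColumn (lookup cl j')
  columns-≺ j j' j<j' t t' top top' (tri≈ _ t≡t' _) =
    inj₂ (sym (cong (countB false) column≡) , LR.colIncr j j' t j<j' top top'')
    where
    top'' : Topmost P j' t
    top'' = subst (Topmost P j') (sym (FP.toℕ-injective t≡t')) top'
    column≡ : stairColumn (lookup cl j) ≡ stairColumn (lookup cl j')
    column≡ = vec-ext λ a → trans (stairColumn-lookup j a)
      (trans (≡true-ext (through top top'' a) (through top'' top a)) (sym (stairColumn-lookup j' a)))
      where
      through : ∀ {j₁ j₂} → Topmost P j₁ t → Topmost P j₂ t → ∀ a →
        (z (rowPos (toℕ a)) ≤ᵇ toℕ j₁) ≡ true → (z (rowPos (toℕ a)) ≤ᵇ toℕ j₂) ≡ true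
      through top₁ top₂ a e = ≤⇒≤ᵇ≡true (proj₂ (z≤⇔≤topmost _ t top₂ _ (rowPos<m a))
                                          (proj₁ (z≤⇔≤topmost _ t top₁ _ (rowPos<m a)) (≤ᵇ≡true⇒≤ e)))
  columns-≺ j j' j<j' t t' top top' (tri< t<t' _ _) =
    inj₁ (countB-mono-< false (stairColumn (lookup cl j)) (stairColumn (lookup cl j')) zeros⊆ a' j-zero j'-one)
    where
    zeros⊆ : stairColumn (lookup cl j') ⊆⟨ false ⟩ stairColumn (lookup cl j)
    zeros⊆ q e = trans (stairColumn-lookup j q) (≰⇒≤ᵇ≡false λ (le : z (rowPos (toℕ q)) ≤ toℕ j) →
      ≡true⇒≢false (trans (stairColumn-lookup j' q) (≤⇒≤ᵇ≡true (≤-trans le (<⇒≤ j<j')))) e)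
    a' : Fin m
    a' = fromℕ< (rl< t')
    rowPos-a' : rowPos (toℕ a') ≡ toℕ t'
    rowPos-a' = trans (cong rowPos (FP.toℕ-fromℕ< (rl< t'))) (rowPos-lookup t')
    j-zero : lookup (stairColumn (lookup cl j)) a' ≡ false
    j-zero = trans (stairColumn-lookup j a') (≰⇒≤ᵇ≡false λ le → <⇒≱ t<t'
      (proj₁ (z≤⇔≤topmost j t top (toℕ t') (FP.toℕ<n t')) (subst (λ w → z w ≤ toℕ j) rowPos-a' le)))
    j'-one : lookup (stairColumn (lookup cl j')) a' ≢ false
    j'-one = ≡true⇒≢false (trans (stairColumn-lookup j' a') (≤⇒≤ᵇ≡true
      (subst (λ w → z w ≤ toℕ j') (sym rowPos-a') (proj₂ (z≤⇔≤topmost j' t' top' (toℕ t') (FP.toℕ<n t')) ≤-refl))))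
  columns-≺ j j' j<j' t t' top top' (tri> _ _ t'<t) =
    ⊥-elim (<⇒≱ t'<t (proj₁ (z≤⇔≤topmost j' t' top' (toℕ t) (FP.toℕ<n t))
                           (≤-trans (proj₂ (z≤⇔≤topmost j t top (toℕ t) (FP.toℕ<n t)) ≤-refl) (<⇒≤ j<j'))))

  sortedCols≡ : FT.sortedCols ≡ columnsByLabel
  sortedCols≡ = toList-injective FT.sortedCols columnsByLabel
    (FT.ColSort.≺-sorted-unique (↭-trans FT.sortedCols-↭ (↭-sym columnsByLabel-↭)) FT.sortedCols-sorted
      (AllPairs-lookup⁻ columnsByLabel λ j j' j<j' →
        subst₂ FT.ColSort._≺_ (sym (columnsByLabel-lookup j)) (sym (columnsByLabel-lookup j'))
          (columns-≺ j j' j<j' _ _ (proj₂ (topmost j)) (proj₂ (topmost j'))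
            (<-cmp (toℕ (proj₁ (topmost j))) (toℕ (proj₁ (topmost j')))))))

  colLabels≡ : FT.colLabels ≡ cl
  colLabels≡ = vec-ext λ j → trans (FT.colLabels-lookup j)
    (trans (cong (λ v → proj₁ (lookup v j)) sortedCols≡) (cong proj₁ (columnsByLabel-lookup j)))

  T₁-staircase : ∀ a j → FT.T₁ ⟨ a , j ⟩ ≡ (z (rowPos (toℕ a)) ≤ᵇ toℕ j)
  T₁-staircase a j = trans (FT.T₁-⟨⟩ a j) (trans (cong (λ v → lookup (proj₂ (lookup v j)) a) sortedCols≡)
    (trans (cong (λ c → lookup (proj₂ c) a) (columnsByLabel-lookup j)) (stairColumn-lookup j a)))

  -- the row of the column-sorted tableau with label c
  stairRow : ℕ → Vec Bool n
  stairRow c = tabulate λ j → entry X (rowPos c) (toℕ j)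

  labelledStairRow : ℕ → ℕ × Vec Bool n
  labelledStairRow c = c , stairRow c

  rowsByLabel : Vec (ℕ × Vec Bool n) m
  rowsByLabel = V.map labelledStairRow rl

  rowsByLabel-↭ : toList rowsByLabel ↭ toList (tabulate FT.labelledRow)
  rowsByLabel-↭ = ↭-trans (↭.↭-reflexive (VP.toList-map labelledStairRow rl))
    (↭-trans (map⁺ labelledStairRow LR.rowPerm)
      (↭.↭-reflexive (trans (LP.map-upTo labelledStairRow m)
        (trans (sym (toList-tabulate-toℕ labelledStairRow)) (cong toList (sym (VP.tabulate-cong labelledRow≡)))))))
    where
    labelledRow≡ : ∀ a → FT.labelledRow a ≡ labelledStairRow (toℕ a)
    labelledRow≡ a = cong (toℕ a ,_) (vec-ext λ j → trans (T₁-staircase a j)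
      (sym (trans (VP.lookup∘tabulate (λ j → entry X (rowPos (toℕ a)) (toℕ j)) j)
                  (entry-X _ _ (rowPos<m a) (FP.toℕ<n j)))))

  stairRow-lookup : ∀ i j → lookup (stairRow (lookup rl i)) j ≡ (z (toℕ i) ≤ᵇ toℕ j)
  stairRow-lookup i j = trans (VP.lookup∘tabulate (λ j → entry X (rowPos (lookup rl i)) (toℕ j)) j)
    (trans (cong (λ w → entry X w (toℕ j)) (rowPos-lookup i)) (entry-X _ _ (FP.toℕ<n i) (FP.toℕ<n j)))

  rowsByLabel-lookup : ∀ i → lookup rowsByLabel i ≡ labelledStairRow (lookup rl i)
  rowsByLabel-lookup i = VP.lookup-map i labelledStairRow rl

  rows-≺ : ∀ (i i' : Fin m) → toℕ i < toℕ i' → z (toℕ i) < z (toℕ i') ⊎ z (toℕ i) ≡ z (toℕ i') →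
    labelledStairRow (lookup rl i) FT.RowSort.≺ labelledStairRow (lookup rl i')
  rows-≺ i i' i<i' (inj₂ z≡) = inj₂ (sym (cong (countB true) row≡) , LR.rowIncr i i' c i<i' (leftmost i) leftmost')
    where
    row≡ : stairRow (lookup rl i) ≡ stairRow (lookup rl i')
    row≡ = vec-ext λ j → trans (stairRow-lookup i j) (trans (cong (_≤ᵇ toℕ j) z≡) (sym (stairRow-lookup i' j)))
    1≤i : 1 ≤ toℕ i
    1≤i = ≰⇒> λ le → <⇒≱ (z-pos (toℕ i') (≤-trans (s≤s z≤n) i<i'))
                         (≤-reflexive (trans (sym z≡) (cong z (n≤0⇒n≡0 le))))
    lo≡ : lo (toℕ i) ≡ lo (toℕ i')
    lo≡ = suc-injective (trans (sym (z≡suc-lo (toℕ i) 1≤i (FP.toℕ<n i)))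
            (trans z≡ (z≡suc-lo (toℕ i') (≤-trans 1≤i (<⇒≤ i<i')) (FP.toℕ<n i'))))
    c : Fin n
    c = fromℕ< (lo<n (toℕ i) (FP.toℕ<n i))
    leftmost' : Leftmost P i' c
    leftmost' = subst (Leftmost P i')
                  (FP.fromℕ<-cong _ _ (sym lo≡) (lo<n (toℕ i') (FP.toℕ<n i')) (lo<n (toℕ i) (FP.toℕ<n i)))
                  (leftmost i')
  rows-≺ i i' i<i' (inj₁ z<z') =
    inj₁ (countB-mono-< true (stairRow (lookup rl i)) (stairRow (lookup rl i')) ones⊆ c i-one i'-zero)
    where
    z<n : z (toℕ i) < n
    z<n = <-≤-trans z<z' (z-bounded (toℕ i'))
    c : Fin n
    c = fromℕ< z<n
    ones⊆ : stairRow (lookup rl i') ⊆⟨ true ⟩ stairRow (lookup rl i)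
    ones⊆ q e = trans (stairRow-lookup i q)
      (≤⇒≤ᵇ≡true (≤-trans (<⇒≤ z<z') (≤ᵇ≡true⇒≤ (trans (sym (stairRow-lookup i' q)) e))))
    i-one : lookup (stairRow (lookup rl i)) c ≡ true
    i-one = trans (stairRow-lookup i c) (≤⇒≤ᵇ≡true (≤-reflexive (sym (FP.toℕ-fromℕ< z<n))))
    i'-zero : lookup (stairRow (lookup rl i')) c ≢ true
    i'-zero e = <⇒≱ z<z'
      (subst (z (toℕ i') ≤_) (FP.toℕ-fromℕ< z<n) (≤ᵇ≡true⇒≤ (trans (sym (stairRow-lookup i' c)) e)))

  sortedRows≡ : FT.sortedRows ≡ rowsByLabel
  sortedRows≡ = toList-injective FT.sortedRows rowsByLabel
    (FT.RowSort.≺-sorted-unique (↭-trans FT.sortedRows-↭ (↭-sym rowsByLabel-↭)) FT.sortedRows-sorted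
      (AllPairs-lookup⁻ rowsByLabel λ i i' i<i' →
        subst₂ FT.RowSort._≺_ (sym (rowsByLabel-lookup i)) (sym (rowsByLabel-lookup i'))
          (rows-≺ i i' i<i' (m≤n⇒m<n∨m≡n (z-mono (toℕ i) (toℕ i') (<⇒≤ i<i') (FP.toℕ<n i'))))))

  rowLabels≡ : FT.rowLabels ≡ rl
  rowLabels≡ = vec-ext λ i → trans (FT.rowLabels-lookup i)
    (trans (cong (λ v → proj₁ (lookup v i)) sortedRows≡) (cong proj₁ (rowsByLabel-lookup i)))

  X≡ : FT.X ≡ X
  X≡ = vec-ext λ i → vec-ext λ j → trans (cong (λ r → lookup r j) (FT.X-row i))
    (trans (cong (λ v → lookup (proj₂ (lookup v i)) j) sortedRows≡)
      (trans (cong (λ c → lookup (proj₂ c) j) (rowsByLabel-lookup i)) (trans (stairRow-lookup i j) (sym (X-⟨⟩ i j)))))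

  φ-T : φ T ≡ (P , rl , cl)
  φ-T = trans FT.φ-≡ (cong₂ _,_ (trans (cong step3 X≡) step3-X) (cong₂ _,_ rowLabels≡ colLabels≡))

φ-surjective : ∀ {k l} (L : Labelled (suc k) (suc l)) → IsLRib L → ∃[ T ] (IsEW T × φ T ≡ L)
φ-surjective (P , rl , cl) lrib = T , T-EW , φ-T
  where open Backward P rl cl lrib

theorem3p8 : ∀ (m n : ℕ) → 1 ≤ m → 1 ≤ n →
    -- φ maps EW_{m,n} into LRib_{m,n}
    (∀ (T : Tableau m n) → IsEW T → IsLRib (φ T)) ×
    -- φ is injective on EW_{m,n}
    (∀ (T T' : Tableau m n) → IsEW T → IsEW T' → φ T ≡ φ T' → T ≡ T') ×
    -- φ is surjective onto LRib_{m,n}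
    (∀ (L : Labelled m n) → IsLRib L → ∃[ T ] (IsEW T × φ T ≡ L))
theorem3p8 (suc k) (suc l) _ _ = Forward.φ-LRib , φ-injective , φ-surjective
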